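{- Let $n,b,d$ be nonnegative integers. Then \[\sum_{k=0}^n \binom{n}{k}^2\frac{\binom{n+bn}{k}\binom{n+dn}{k}}{\binom{k+bn}{k}\binom{k+dn}{k}}\Big\{1+(n-2k)\big(2H_k+H_{bn+k}+H_{dn+k}\big)\Big\} = (-1)^n\frac{\binom{2n+bn+dn}{n}}{\binom{n+bn}{n}\binom{n+dn}{n}}.\]
   Context: $H_0=0$ and $H_m=\sum_{j=1}^m \frac{1}{j}$ for positive integers $m$ (classical harmonic numbers). -}

module Defs where

open import Data.Nat using (ℕ; zero; suc; _+_; _*_)
open import Data.Nat.Combinatorics using (_C_)
open import Data.Integer using (+_)
open import Data.Rational using (ℚ; 0ℚ; _/_) renaming (_+_ to _+ℚ_; _*_ to _*ℚ_)
open import Data.List using (List; upTo; map; foldr)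

-- Rational a / b for natural numbers; convention: value 0 when b = 0
-- (only ever used with positive denominators below).
_÷ℕ_ : ℕ → ℕ → ℚ
a ÷ℕ zero = 0ℚ
a ÷ℕ suc b = (+ a) / suc b

sumTo : ℕ → (ℕ → ℚ) → ℚ
sumTo n f = foldr _+ℚ_ 0ℚ (map f (upTo (suc n)))

H : ℕ → ℚ
H zero = 0ℚ
H (suc m) = H m +ℚ (1 ÷ℕ suc m)

sign : ℕ → ℚ
sign zero = + 1 / 1
sign (suc n) = Data.Rational.- sign n

-- Creative telescoping (Zeilberger), with x = bn and y = dn treated as independent parameters.
-- Write t(n,k) for the binomial quotient in the summand and h(k) = 2H_k + H_{x+k} + H_{y+k}, so that
-- the summand is t + h·w with w(n,k) = (n − 2k)·t(n,k). Moving n or k by one multiplies t by a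
-- quotient of values of ψ(z) = z²(z+x)(z+y), and h(k+1) − h(k) = δ(k)/φ(k+1) with φ(z) = z(z+x)(z+y).
-- Hence the explicit antidifferences t(n+1,k)·ψ(k)·B and t(n+1,k)·(k·A + ψ(k)·B·h(k)) reduce the
-- telescoping relations to two polynomial identities, and give, with P₁ > 0,
--   P₀·Z(n) + P₁·Z(n+1) = 0   and   P₀·L(n) + P₁·L(n+1) + (Q₀·Z(n) + Q₁·Z(n+1)) = 0
-- for Z(n) = Σ_k w(n,k) and the left-hand side L(n). Since Z(0) = 0, Z vanishes identically; the
-- right-hand side satisfies the same recurrence as L and agrees with it at n = 0.
module Submission where

open import Defs
open import Data.Nat using (ℕ; _+_; _*_)
open import Data.Nat.Combinatorics using (_C_)
open import Data.Integer using (+_)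
open import Data.Rational using (ℚ; _/_) renaming (_+_ to _+ℚ_; _*_ to _*ℚ_; _-_ to _-ℚ_)
open import Relation.Binary.PropositionalEquality using (_≡_)

open import Data.Nat.Base as ℕ using (zero; suc; _∸_; _≤_; _<_; z≤n; s≤s)
import Data.Nat.Properties as ℕ
open import Data.Nat.Combinatorics using (nC1≡n; nCk+nC[k+1]≡[n+1]C[k+1]; k>n⇒nCk≡0)
open import Data.Nat.Tactic.RingSolver using (solve-∀)
open import Data.Integer.Base as ℤ using (ℤ; +[1+_]; -[1+_])
import Data.Integer.Properties as ℤ
open import Data.Rational.Base as ℚ using (mkℚ; 0ℚ; 1ℚ)
import Data.Rational.Properties as ℚ
import Data.Rational.Unnormalised.Base as ℚᵘ
import Data.Rational.Unnormalised.Properties as ℚᵘ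
import Data.Nat.Coprimality as Coprimality
open import Data.List.Base using (applyUpTo; foldr; map)
open import Function.Base using (_∘_; id)
open import Data.Fin using (#_)
open import Data.Vec.Base using ([]; _∷_)
open import Data.Product.Base using (_×_; _,_; proj₁; proj₂)
open import Data.Maybe.Base using (Maybe; just; nothing)
open import Relation.Nullary.Decidable.Core using (yes; no)
open import Relation.Binary.PropositionalEquality using (refl; sym; trans; cong; cong₂; module ≡-Reasoning)
open import Algebra.Solver.Ring.AlmostCommutativeRing using (fromCommutativeRing; _-Raw-AlmostCommutative⟶_)
import Algebra.Solver.Ring
open import Algebra.Properties.Group ℚ.+-0-group using (⁻¹-involutive; inverseʳ-unique)

fromℤ : ℤ → ℚ
fromℤ z = z / 1

fromℕ : ℕ → ℚ
fromℕ n = fromℤ (+ n)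

fromℤ≡mkℚ : ∀ z → fromℤ z ≡ mkℚ z 0 (Coprimality.sym (Coprimality.1-coprimeTo ℤ.∣ z ∣))
fromℤ≡mkℚ z = ℚ.↥p/↧p≡p (mkℚ z 0 _)

fromℤ-+ : ∀ a b → fromℤ (a ℤ.+ b) ≡ fromℤ a +ℚ fromℤ b
fromℤ-+ a b = trans (cong fromℤ (sym (cong₂ ℤ._+_ (ℤ.*-identityʳ a) (ℤ.*-identityʳ b)))) (sym (cong₂ _+ℚ_ (fromℤ≡mkℚ a) (fromℤ≡mkℚ b)))

fromℤ-* : ∀ a b → fromℤ (a ℤ.* b) ≡ fromℤ a *ℚ fromℤ b
fromℤ-* a b = sym (cong₂ _*ℚ_ (fromℤ≡mkℚ a) (fromℤ≡mkℚ b))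

fromℤ-neg : ∀ a → fromℤ (ℤ.- a) ≡ ℚ.- fromℤ a
fromℤ-neg (+ zero)   = refl
fromℤ-neg +[1+ n ]   = refl
fromℤ-neg -[1+ n ]   = sym (⁻¹-involutive (fromℤ (+[1+ n ])))

fromℤ-homomorphism : ℤ.+-*-rawRing -Raw-AlmostCommutative⟶ fromCommutativeRing ℚ.+-*-commutativeRing
fromℤ-homomorphism = record
  { ⟦_⟧ = fromℤ ; +-homo = fromℤ-+ ; *-homo = fromℤ-* ; -‿homo = fromℤ-neg ; 0-homo = refl ; 1-homo = refl }

fromℤ-≟ : ∀ a b → Maybe (fromℤ a ≡ fromℤ b)
fromℤ-≟ a b with a ℤ.≟ b
... | yes a≡b = just (cong fromℤ a≡b)
... | no _    = nothing

module ℚ-Poly = Algebra.Solver.Ring ℤ.+-*-rawRing (fromCommutativeRing ℚ.+-*-commutativeRing) fromℤ-homomorphism fromℤ-≟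
open ℚ-Poly using (Polynomial; solve; _:=_; _:+_; _:*_; _:-_; :-_; _:^_; con; var)

fromℕ-+ : ∀ a b → fromℕ (a + b) ≡ fromℕ a +ℚ fromℕ b
fromℕ-+ a b = fromℤ-+ (+ a) (+ b)

fromℕ-* : ∀ a b → fromℕ (a * b) ≡ fromℕ a *ℚ fromℕ b
fromℕ-* a b = trans (cong fromℤ (ℤ.pos-* a b)) (fromℤ-* (+ a) (+ b))

fromℕ-suc : ∀ a → fromℕ (suc a) ≡ fromℕ a +ℚ 1ℚ
fromℕ-suc a = trans (cong fromℕ (ℕ.+-comm 1 a)) (fromℕ-+ a 1)

fromℕ-∸ : ∀ a b → b ≤ a → fromℕ (a ∸ b) ≡ fromℕ a -ℚ fromℕ b
fromℕ-∸ a b b≤a = begin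
  fromℕ (a ∸ b)                       ≡⟨ add-sub (fromℕ (a ∸ b)) (fromℕ b) ⟩
  (fromℕ (a ∸ b) +ℚ fromℕ b) -ℚ fromℕ b ≡⟨ cong (_-ℚ fromℕ b) (sym (fromℕ-+ (a ∸ b) b)) ⟩
  fromℕ (a ∸ b + b) -ℚ fromℕ b         ≡⟨ cong (λ c → fromℕ c -ℚ fromℕ b) (ℕ.m∸n+n≡m b≤a) ⟩
  fromℕ a -ℚ fromℕ b                   ∎
  where
  open ≡-Reasoning
  add-sub : ∀ u v → u ≡ u +ℚ v -ℚ v
  add-sub = solve 2 (λ u v → u := u :+ v :- v) refl

*-cancelʳ-fromℕ : ∀ {q} a b → 0 < q → a *ℚ fromℕ q ≡ b *ℚ fromℕ q → a ≡ b
*-cancelʳ-fromℕ {suc q} a b _ eq = begin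
  a                     ≡⟨ sym (ℚ.*-identityʳ a) ⟩
  a *ℚ 1ℚ               ≡⟨ cong (a *ℚ_) (sym q*q⁻¹≡1) ⟩
  a *ℚ (Q *ℚ Q⁻¹)       ≡⟨ sym (ℚ.*-assoc a Q Q⁻¹) ⟩
  a *ℚ Q *ℚ Q⁻¹         ≡⟨ cong (_*ℚ Q⁻¹) eq ⟩
  b *ℚ Q *ℚ Q⁻¹         ≡⟨ ℚ.*-assoc b Q Q⁻¹ ⟩
  b *ℚ (Q *ℚ Q⁻¹)       ≡⟨ cong (b *ℚ_) q*q⁻¹≡1 ⟩
  b *ℚ 1ℚ               ≡⟨ ℚ.*-identityʳ b ⟩
  b                     ∎
  where
  open ≡-Reasoning
  Q Q⁻¹ : ℚ
  Q = fromℕ (suc q)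
  instance
    Q≢0 : ℚ.NonZero Q
    Q≢0 = ℚ.pos⇒nonZero Q {{ℚ.normalize-pos (suc q) 1}}
  Q⁻¹ = ℚ.1/ Q
  q*q⁻¹≡1 : Q *ℚ Q⁻¹ ≡ 1ℚ
  q*q⁻¹≡1 = ℚ.*-inverseʳ Q

*-cancelˡ-fromℕ : ∀ {q} a b → 0 < q → fromℕ q *ℚ a ≡ fromℕ q *ℚ b → a ≡ b
*-cancelˡ-fromℕ {q} a b 0<q eq = *-cancelʳ-fromℕ a b 0<q (trans (ℚ.*-comm a (fromℕ q)) (trans eq (ℚ.*-comm (fromℕ q) b)))

÷ℕ-*-denominator : ∀ a d → 0 < d → (a ÷ℕ d) *ℚ fromℕ d ≡ fromℕ a
÷ℕ-*-denominator a (suc d) _ = ℚ.toℚᵘ-injective (begin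
  ℚ.toℚᵘ ((+ a / suc d) *ℚ fromℕ (suc d))           ≈⟨ ℚ.toℚᵘ-homo-* (+ a / suc d) (fromℕ (suc d)) ⟩
  ℚ.toℚᵘ (+ a / suc d) ℚᵘ.* ℚ.toℚᵘ (fromℕ (suc d))  ≈⟨ ℚᵘ.*-cong (ℚ.toℚᵘ-fromℚᵘ (ℚᵘ.mkℚᵘ (+ a) d))
                                                          (ℚᵘ.≃-reflexive (cong ℚ.toℚᵘ (fromℤ≡mkℚ (+ suc d)))) ⟩
  ℚᵘ.mkℚᵘ (+ a) d ℚᵘ.* ℚᵘ.mkℚᵘ (+ suc d) 0          ≈⟨ ℚᵘ.*≡* cross ⟩
  ℚᵘ.mkℚᵘ (+ a) 0                                    ≡⟨ cong ℚ.toℚᵘ (fromℤ≡mkℚ (+ a)) ⟨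
  ℚ.toℚᵘ (fromℕ a)                                   ∎)
  where
  open ℚᵘ.≃-Reasoning
  cross : (+ a ℤ.* + suc d) ℤ.* + 1 ≡ + a ℤ.* + (suc d ℕ.* 1)
  cross = trans (ℤ.*-identityʳ _) (cong (λ m → + a ℤ.* + m) (sym (ℕ.*-identityʳ (suc d))))

infixl 6 _⊕_
infixl 7 _⊗_

data ℕ-Expr : Set where
  ⌜_⌝     : ℕ → ℕ-Expr
  _⊕_ _⊗_ : ℕ-Expr → ℕ-Expr → ℕ-Expr

⟦_⟧ℕ : ℕ-Expr → ℕ
⟦ ⌜ a ⌝ ⟧ℕ = a
⟦ e ⊕ f ⟧ℕ = ⟦ e ⟧ℕ + ⟦ f ⟧ℕ
⟦ e ⊗ f ⟧ℕ = ⟦ e ⟧ℕ * ⟦ f ⟧ℕ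

⟦_⟧ℚ : ℕ-Expr → ℚ
⟦ ⌜ a ⌝ ⟧ℚ = fromℕ a
⟦ e ⊕ f ⟧ℚ = ⟦ e ⟧ℚ +ℚ ⟦ f ⟧ℚ
⟦ e ⊗ f ⟧ℚ = ⟦ e ⟧ℚ *ℚ ⟦ f ⟧ℚ

fromℕ-⟦⟧ : ∀ e → fromℕ ⟦ e ⟧ℕ ≡ ⟦ e ⟧ℚ
fromℕ-⟦⟧ ⌜ a ⌝   = refl
fromℕ-⟦⟧ (e ⊕ f) = trans (fromℕ-+ ⟦ e ⟧ℕ ⟦ f ⟧ℕ) (cong₂ _+ℚ_ (fromℕ-⟦⟧ e) (fromℕ-⟦⟧ f))
fromℕ-⟦⟧ (e ⊗ f) = trans (fromℕ-* ⟦ e ⟧ℕ ⟦ f ⟧ℕ) (cong₂ _*ℚ_ (fromℕ-⟦⟧ e) (fromℕ-⟦⟧ f))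

0÷ℕ : ∀ d → 0 ÷ℕ d ≡ 0ℚ
0÷ℕ zero    = refl
0÷ℕ (suc d) = ℚ.0/n≡0 (suc d)

÷ℕ-*-cross : ∀ {a₁ d₁ a₂ d₂} e₁ e₂ → 0 < d₁ → 0 < d₂ → a₁ * d₂ * e₁ ≡ a₂ * d₁ * e₂ →
             (a₁ ÷ℕ d₁) *ℚ fromℕ e₁ ≡ (a₂ ÷ℕ d₂) *ℚ fromℕ e₂
÷ℕ-*-cross {a₁} {d₁} {a₂} {d₂} e₁ e₂ 0<d₁ 0<d₂ eq = *-cancelʳ-fromℕ _ _ (ℕ.*-mono-< 0<d₁ 0<d₂) (begin
  (q₁ *ℚ E₁) *ℚ fromℕ (d₁ * d₂)   ≡⟨ cong ((q₁ *ℚ E₁) *ℚ_) (fromℕ-* d₁ d₂) ⟩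
  (q₁ *ℚ E₁) *ℚ (D₁ *ℚ D₂)        ≡⟨ regroup q₁ E₁ D₁ D₂ ⟩
  (q₁ *ℚ D₁) *ℚ D₂ *ℚ E₁          ≡⟨ cong (λ c → c *ℚ D₂ *ℚ E₁) (÷ℕ-*-denominator a₁ d₁ 0<d₁) ⟩
  fromℕ a₁ *ℚ D₂ *ℚ E₁            ≡⟨ sym (fromℕ-⟦⟧ (⌜ a₁ ⌝ ⊗ ⌜ d₂ ⌝ ⊗ ⌜ e₁ ⌝)) ⟩
  fromℕ (a₁ * d₂ * e₁)            ≡⟨ cong fromℕ eq ⟩
  fromℕ (a₂ * d₁ * e₂)            ≡⟨ fromℕ-⟦⟧ (⌜ a₂ ⌝ ⊗ ⌜ d₁ ⌝ ⊗ ⌜ e₂ ⌝) ⟩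
  fromℕ a₂ *ℚ D₁ *ℚ E₂            ≡⟨ cong (λ c → c *ℚ D₁ *ℚ E₂) (÷ℕ-*-denominator a₂ d₂ 0<d₂) ⟨
  (q₂ *ℚ D₂) *ℚ D₁ *ℚ E₂          ≡⟨ regroup q₂ E₂ D₂ D₁ ⟨
  (q₂ *ℚ E₂) *ℚ (D₂ *ℚ D₁)        ≡⟨ cong ((q₂ *ℚ E₂) *ℚ_) (ℚ.*-comm D₂ D₁) ⟩
  (q₂ *ℚ E₂) *ℚ (D₁ *ℚ D₂)        ≡⟨ cong ((q₂ *ℚ E₂) *ℚ_) (fromℕ-* d₁ d₂) ⟨
  (q₂ *ℚ E₂) *ℚ fromℕ (d₁ * d₂)   ∎)
  where
  open ≡-Reasoning
  q₁ q₂ D₁ D₂ E₁ E₂ : ℚ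
  q₁ = a₁ ÷ℕ d₁
  q₂ = a₂ ÷ℕ d₂
  D₁ = fromℕ d₁
  D₂ = fromℕ d₂
  E₁ = fromℕ e₁
  E₂ = fromℕ e₂
  regroup : ∀ q e u v → (q *ℚ e) *ℚ (u *ℚ v) ≡ (q *ℚ u) *ℚ v *ℚ e
  regroup = solve 4 (λ q e u v → (q :* e) :* (u :* v) := (q :* u) :* v :* e) refl

C-absorb : ∀ m k → suc k * (suc m C suc k) ≡ suc m * (m C k)
C-absorb m zero = begin
  1 * (suc m C 1)  ≡⟨ ℕ.*-identityˡ (suc m C 1) ⟩
  suc m C 1        ≡⟨ nC1≡n (suc m) ⟩
  suc m            ≡⟨ ℕ.*-identityʳ (suc m) ⟨
  suc m * 1        ∎
  where open ≡-Reasoning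
C-absorb zero (suc k) = ℕ.*-zeroʳ (suc (suc k))
C-absorb (suc m) (suc k) = begin
  suc (suc k) * (suc (suc m) C suc (suc k))  ≡⟨ cong (suc (suc k) *_) (nCk+nC[k+1]≡[n+1]C[k+1] (suc m) (suc k)) ⟨
  suc (suc k) * (c₁ + c₂)                    ≡⟨ expand (suc k) c₁ c₂ ⟩
  c₁ + suc k * c₁ + suc (suc k) * c₂         ≡⟨ cong₂ (λ u v → c₁ + u + v) (C-absorb m k) (C-absorb m (suc k)) ⟩
  c₁ + suc m * (m C k) + suc m * (m C suc k) ≡⟨ factor c₁ (suc m) (m C k) (m C suc k) ⟩
  c₁ + suc m * (m C k + m C suc k)           ≡⟨ cong (λ c → c₁ + suc m * c) (nCk+nC[k+1]≡[n+1]C[k+1] m k) ⟩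
  suc (suc m) * c₁                           ∎
  where
  open ≡-Reasoning
  c₁ c₂ : ℕ
  c₁ = suc m C suc k
  c₂ = suc m C suc (suc k)
  expand : ∀ k a b → suc k * (a + b) ≡ a + k * a + suc k * b
  expand = solve-∀
  factor : ∀ a m b c → a + m * b + m * c ≡ a + m * (b + c)
  factor = solve-∀

C-down : ∀ {m} k j → k + j ≡ m → (m C suc k) * suc k ≡ j * (m C k)
C-down k j refl = ℕ.+-cancelˡ-≡ (suc k * c₀) _ _ (begin
  suc k * c₀ + c₁ * suc k        ≡⟨ factor (suc k) c₀ c₁ ⟩
  suc k * (c₀ + c₁)              ≡⟨ cong (suc k *_) (nCk+nC[k+1]≡[n+1]C[k+1] (k + j) k) ⟩
  suc k * (suc (k + j) C suc k)  ≡⟨ C-absorb (k + j) k ⟩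
  suc (k + j) * c₀               ≡⟨ split k j c₀ ⟩
  suc k * c₀ + j * c₀            ∎)
  where
  open ≡-Reasoning
  c₀ c₁ : ℕ
  c₀ = (k + j) C k
  c₁ = (k + j) C suc k
  factor : ∀ a b c → a * b + c * a ≡ a * (b + c)
  factor = solve-∀
  split : ∀ k j c → suc (k + j) * c ≡ suc k * c + j * c
  split = solve-∀

C-shift : ∀ {m} k j → k + j ≡ suc m → (suc m C k) * j ≡ suc m * (m C k)
C-shift         zero    j refl    = ℕ.*-comm 1 j
C-shift {m} (suc k) j k+j≡1+m = ℕ.*-cancelˡ-≡ _ _ (suc k) (begin
  suc k * ((suc m C suc k) * j)    ≡⟨ ℕ.*-assoc (suc k) (suc m C suc k) j ⟨
  suc k * (suc m C suc k) * j      ≡⟨ cong (_* j) (C-absorb m k) ⟩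
  suc m * (m C k) * j              ≡⟨ rearrange (suc m) (m C k) j ⟩
  suc m * (j * (m C k))            ≡⟨ cong (suc m *_) (C-down k j (ℕ.suc-injective k+j≡1+m)) ⟨
  suc m * ((m C suc k) * suc k)    ≡⟨ rotate (suc m) (m C suc k) (suc k) ⟩
  suc k * (suc m * (m C suc k))    ∎)
  where
  open ≡-Reasoning
  rearrange : ∀ a b c → a * b * c ≡ a * (c * b)
  rearrange = solve-∀
  rotate : ∀ a b c → a * (b * c) ≡ c * (a * b)
  rotate = solve-∀

C-pos : ∀ {m k} → k ≤ m → 0 < m C k
C-pos {m}     {zero}  _         = s≤s z≤n
C-pos {suc m} {suc k} (s≤s k≤m) = begin-strict
  0                       <⟨ C-pos k≤m ⟩
  m C k                   ≤⟨ ℕ.m≤m+n (m C k) (m C suc k) ⟩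
  m C k + m C suc k       ≡⟨ nCk+nC[k+1]≡[n+1]C[k+1] m k ⟩
  suc m C suc k           ∎
  where open ℕ.≤-Reasoning

∑ : ℕ → (ℕ → ℚ) → ℚ
∑ zero    f = 0ℚ
∑ (suc m) f = ∑ m f +ℚ f m

∑-suc : ∀ m f → ∑ (suc m) f ≡ f 0 +ℚ ∑ m (f ∘ suc)
∑-suc zero    f = ℚ.+-comm 0ℚ (f 0)
∑-suc (suc m) f = trans (cong (_+ℚ f (suc m)) (∑-suc m f)) (ℚ.+-assoc (f 0) _ _)

foldr-applyUpTo≡∑ : ∀ m (g : ℕ → ℕ) (f : ℕ → ℚ) → foldr _+ℚ_ 0ℚ (map f (applyUpTo g m)) ≡ ∑ m (f ∘ g)
foldr-applyUpTo≡∑ zero    g f = refl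
foldr-applyUpTo≡∑ (suc m) g f =
  trans (cong (f (g 0) +ℚ_) (foldr-applyUpTo≡∑ m (g ∘ suc) f)) (sym (∑-suc m (f ∘ g)))

sumTo≡∑ : ∀ n f → sumTo n f ≡ ∑ (suc n) f
sumTo≡∑ n = foldr-applyUpTo≡∑ (suc n) id

∑-cong : ∀ m {f g} → (∀ k → k < m → f k ≡ g k) → ∑ m f ≡ ∑ m g
∑-cong zero    f≡g = refl
∑-cong (suc m) f≡g = cong₂ _+ℚ_ (∑-cong m (λ k k<m → f≡g k (ℕ.m<n⇒m<1+n k<m))) (f≡g m (ℕ.n<1+n m))

∑-+ : ∀ m f g → ∑ m (λ k → f k +ℚ g k) ≡ ∑ m f +ℚ ∑ m g
∑-+ zero    f g = refl
∑-+ (suc m) f g = trans (cong (_+ℚ (f m +ℚ g m)) (∑-+ m f g)) (swap (∑ m f) (∑ m g) (f m) (g m))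
  where
  swap : ∀ a b c d → (a +ℚ b) +ℚ (c +ℚ d) ≡ (a +ℚ c) +ℚ (b +ℚ d)
  swap = solve 4 (λ a b c d → (a :+ b) :+ (c :+ d) := (a :+ c) :+ (b :+ d)) refl

∑-*ˡ : ∀ m c f → ∑ m (λ k → c *ℚ f k) ≡ c *ℚ ∑ m f
∑-*ˡ zero    c f = sym (ℚ.*-zeroʳ c)
∑-*ˡ (suc m) c f = trans (cong (_+ℚ c *ℚ f m) (∑-*ˡ m c f)) (sym (ℚ.*-distribˡ-+ c (∑ m f) (f m)))

∑-linear : ∀ m a b f g → ∑ m (λ k → a *ℚ f k +ℚ b *ℚ g k) ≡ a *ℚ ∑ m f +ℚ b *ℚ ∑ m g
∑-linear m a b f g = trans (∑-+ m _ _) (cong₂ _+ℚ_ (∑-*ˡ m a f) (∑-*ˡ m b g))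

∑-suc-vanishing : ∀ m f → f m ≡ 0ℚ → ∑ (suc m) f ≡ ∑ m f
∑-suc-vanishing m f fm≡0 = trans (cong (∑ m f +ℚ_) fm≡0) (ℚ.+-identityʳ (∑ m f))

∑-telescope : ∀ m (g : ℕ → ℚ) → ∑ m (λ k → g (suc k) -ℚ g k) ≡ g m -ℚ g 0
∑-telescope zero    g = sym (ℚ.+-inverseʳ (g 0))
∑-telescope (suc m) g = trans (cong (_+ℚ (g (suc m) -ℚ g m)) (∑-telescope m g)) (collapse (g (suc m)) (g m) (g 0))
  where
  collapse : ∀ a b c → (b -ℚ c) +ℚ (a -ℚ b) ≡ a -ℚ c
  collapse = solve 3 (λ a b c → (b :- c) :+ (a :- b) := a :- c) refl

∑-telescope-vanishes : ∀ {q} m (f G : ℕ → ℚ) → 0 < q →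
  (∀ k → k < m → fromℕ q *ℚ f k ≡ G (suc k) -ℚ G k) → G m ≡ 0ℚ → G 0 ≡ 0ℚ → ∑ m f ≡ 0ℚ
∑-telescope-vanishes {q} m f G 0<q step Gm≡0 G0≡0 = *-cancelˡ-fromℕ (∑ m f) 0ℚ 0<q (begin
  fromℕ q *ℚ ∑ m f               ≡⟨ ∑-*ˡ m (fromℕ q) f ⟨
  ∑ m (λ k → fromℕ q *ℚ f k)     ≡⟨ ∑-cong m step ⟩
  ∑ m (λ k → G (suc k) -ℚ G k)   ≡⟨ ∑-telescope m G ⟩
  G m -ℚ G 0                     ≡⟨ cong₂ _-ℚ_ Gm≡0 G0≡0 ⟩
  0ℚ                             ≡⟨ ℚ.*-zeroʳ (fromℕ q) ⟨
  fromℕ q *ℚ 0ℚ                  ∎)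
  where open ≡-Reasoning

first-order-recurrence-unique : ∀ (a : ℕ → ℚ) (b : ℕ → ℕ) {u v : ℕ → ℚ} → (∀ n → 0 < b n) →
  (∀ n → a n *ℚ u n +ℚ fromℕ (b n) *ℚ u (suc n) ≡ 0ℚ) →
  (∀ n → a n *ℚ v n +ℚ fromℕ (b n) *ℚ v (suc n) ≡ 0ℚ) →
  u 0 ≡ v 0 → ∀ n → u n ≡ v n
first-order-recurrence-unique a b         0<b rec-u rec-v u₀≡v₀ zero    = u₀≡v₀
first-order-recurrence-unique a b {u} {v} 0<b rec-u rec-v u₀≡v₀ (suc n) =
  *-cancelˡ-fromℕ (u (suc n)) (v (suc n)) (0<b n) (begin
    fromℕ (b n) *ℚ u (suc n)   ≡⟨ inverseʳ-unique _ _ (rec-u n) ⟩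
    ℚ.- (a n *ℚ u n)           ≡⟨ cong (λ w → ℚ.- (a n *ℚ w)) (first-order-recurrence-unique a b 0<b rec-u rec-v u₀≡v₀ n) ⟩
    ℚ.- (a n *ℚ v n)           ≡⟨ inverseʳ-unique _ _ (rec-v n) ⟨
    fromℕ (b n) *ℚ v (suc n)   ∎)
  where open ≡-Reasoning

-- Polynomials are written once, as solver syntax: ⟦_⟧₃ and ⟦_⟧₄ evaluate them at rationals, and
-- the same terms are handed to solve.
Poly₃ Poly₄ : Set
Poly₃ = ∀ {m} → Polynomial m → Polynomial m → Polynomial m → Polynomial m
Poly₄ = ∀ {m} → Polynomial m → Polynomial m → Polynomial m → Polynomial m → Polynomial m

⟦_⟧₃ : Poly₃ → ℚ → ℚ → ℚ → ℚ
⟦ F ⟧₃ a b c = ℚ-Poly.⟦ F (var (# 0)) (var (# 1)) (var (# 2)) ⟧ (a ∷ b ∷ c ∷ [])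

⟦_⟧₄ : Poly₄ → ℚ → ℚ → ℚ → ℚ → ℚ
⟦ F ⟧₄ a b c d = ℚ-Poly.⟦ F (var (# 0)) (var (# 1)) (var (# 2)) (var (# 3)) ⟧ (a ∷ b ∷ c ∷ d ∷ [])

ν : ∀ {m} → ℕ → Polynomial m
ν c = con (+ c)

φ ψ δ : Poly₃
φ X Y z = z :* (z :+ X) :* (z :+ Y)
ψ X Y z = z :* φ X Y z
δ {m} X Y K = ν 2 :* (K′ :+ X) :* (K′ :+ Y) :+ K′ :* (K′ :+ Y) :+ K′ :* (K′ :+ X)
  where
  K′ : Polynomial m
  K′ = K :+ ν 1

-- The certificate found by Zeilberger's algorithm, in the variables x, y, S = n + 1 and K = k.
W β : Poly₃
W X Y S = ν 2 :* S :+ X :+ Y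
β X Y S = ν 5 :* S :^ 3 :+ ν 6 :* S :^ 2 :* X :+ ν 6 :* S :^ 2 :* Y :+ ν 2 :* S :* X :^ 2 :+ ν 5 :* S :* X :* Y
          :+ ν 2 :* S :* Y :^ 2 :+ X :^ 2 :* Y :+ X :* Y :^ 2

P₀ P₁ Q₀ Q₁ : Poly₃
P₀ X Y S = S :* S :* W X Y S :* W X Y S :* (W X Y S :- ν 1)
P₁ X Y S = S :* W X Y S :* (S :+ X :+ Y) :* (S :+ X) :* (S :+ Y)
Q₀ X Y S = :- (ν 2 :* S :* S :* W X Y S :* W X Y S)
Q₁ X Y S =
  :- (ν 10 :* S :^ 4) :- ν 20 :* S :^ 3 :* X :- ν 20 :* S :^ 3 :* Y :- ν 13 :* S :^ 2 :* X :^ 2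
  :- ν 28 :* S :^ 2 :* X :* Y :- ν 13 :* S :^ 2 :* Y :^ 2 :- ν 3 :* S :* X :^ 3 :- ν 11 :* S :* X :^ 2 :* Y
  :- ν 11 :* S :* X :* Y :^ 2 :- ν 3 :* S :* Y :^ 3 :- X :^ 3 :* Y :- ν 2 :* X :^ 2 :* Y :^ 2 :- X :* Y :^ 3

A B : Poly₄
A {m} X Y S K = S :* S :* (a₀ :+ K :* (a₁ :+ K :* (a₂ :+ K :* (a₃ :+ K :* a₄))))
  where
  a₀ a₁ a₂ a₃ a₄ : Polynomial m
  a₀ = :- (ν 2 :* X :* Y :* W X Y S :* β X Y S)
  a₁ = :- (ν 30 :* S :^ 4 :* X) :- ν 30 :* S :^ 4 :* Y :- ν 51 :* S :^ 3 :* X :^ 2 :- ν 86 :* S :^ 3 :* X :* Y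
       :- ν 51 :* S :^ 3 :* Y :^ 2 :- ν 30 :* S :^ 2 :* X :^ 3 :- ν 75 :* S :^ 2 :* X :^ 2 :* Y
       :- ν 75 :* S :^ 2 :* X :* Y :^ 2 :- ν 30 :* S :^ 2 :* Y :^ 3 :- ν 6 :* S :* X :^ 4 :- ν 24 :* S :* X :^ 3 :* Y
       :- ν 36 :* S :* X :^ 2 :* Y :^ 2 :- ν 24 :* S :* X :* Y :^ 3 :- ν 6 :* S :* Y :^ 4 :- ν 2 :* X :^ 4 :* Y
       :- ν 5 :* X :^ 3 :* Y :^ 2 :- ν 5 :* X :^ 2 :* Y :^ 3 :- ν 2 :* X :* Y :^ 4
  a₂ = :- (ν 40 :* S :^ 4) :- ν 40 :* S :^ 3 :* X :- ν 40 :* S :^ 3 :* Y :- ν 3 :* S :^ 2 :* X :^ 2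
       :- ν 18 :* S :^ 2 :* X :* Y :- ν 3 :* S :^ 2 :* Y :^ 2 :+ ν 8 :* S :* X :^ 3 :+ ν 8 :* S :* X :^ 2 :* Y
       :+ ν 8 :* S :* X :* Y :^ 2 :+ ν 8 :* S :* Y :^ 3 :+ ν 2 :* X :^ 4 :+ ν 4 :* X :^ 3 :* Y
       :+ ν 4 :* X :^ 2 :* Y :^ 2 :+ ν 4 :* X :* Y :^ 3 :+ ν 2 :* Y :^ 4
  a₃ = ν 40 :* S :^ 3 :+ ν 45 :* S :^ 2 :* X :+ ν 45 :* S :^ 2 :* Y :+ ν 15 :* S :* X :^ 2 :+ ν 30 :* S :* X :* Y
       :+ ν 15 :* S :* Y :^ 2 :+ X :^ 3 :+ ν 4 :* X :^ 2 :* Y :+ ν 4 :* X :* Y :^ 2 :+ Y :^ 3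
  a₄ = :- (ν 3 :* W X Y S :* W X Y S)
B X Y S K = S :* S :* W X Y S :* (β X Y S :- W X Y S :* (W X Y S :+ S) :* K :+ W X Y S :* K :* K)

certificate-Z : ∀ X Y S K →
  ⟦ P₀ ⟧₃ X Y S *ℚ ⟦ ψ ⟧₃ X Y (S -ℚ K) *ℚ (S -ℚ 1ℚ -ℚ fromℕ 2 *ℚ K)
    +ℚ ⟦ P₁ ⟧₃ X Y S *ℚ ⟦ ψ ⟧₃ X Y S *ℚ (S -ℚ fromℕ 2 *ℚ K)
  ≡ ⟦ ψ ⟧₃ X Y (S -ℚ K) *ℚ ⟦ B ⟧₄ X Y S (K +ℚ 1ℚ) -ℚ ⟦ ψ ⟧₃ X Y K *ℚ ⟦ B ⟧₄ X Y S K
certificate-Z = solve 4 (λ X Y S K →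
  P₀ X Y S :* ψ X Y (S :- K) :* (S :- ν 1 :- ν 2 :* K) :+ P₁ X Y S :* ψ X Y S :* (S :- ν 2 :* K)
  := ψ X Y (S :- K) :* B X Y S (K :+ ν 1) :- ψ X Y K :* B X Y S K) refl

certificate-T : ∀ X Y S K →
  ⟦ φ ⟧₃ X Y (K +ℚ 1ℚ) *ℚ
    (⟦ P₀ ⟧₃ X Y S *ℚ ⟦ ψ ⟧₃ X Y (S -ℚ K) +ℚ ⟦ P₁ ⟧₃ X Y S *ℚ ⟦ ψ ⟧₃ X Y S
     +ℚ ⟦ Q₀ ⟧₃ X Y S *ℚ (S -ℚ 1ℚ -ℚ fromℕ 2 *ℚ K) *ℚ ⟦ ψ ⟧₃ X Y (S -ℚ K)
     +ℚ ⟦ Q₁ ⟧₃ X Y S *ℚ (S -ℚ fromℕ 2 *ℚ K) *ℚ ⟦ ψ ⟧₃ X Y S)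
  ≡ ⟦ ψ ⟧₃ X Y (S -ℚ K) *ℚ (⟦ A ⟧₄ X Y S (K +ℚ 1ℚ) +ℚ ⟦ B ⟧₄ X Y S (K +ℚ 1ℚ) *ℚ ⟦ δ ⟧₃ X Y K)
    -ℚ ⟦ φ ⟧₃ X Y (K +ℚ 1ℚ) *ℚ K *ℚ ⟦ A ⟧₄ X Y S K
certificate-T = solve 4 (λ X Y S K →
  φ X Y (K :+ ν 1) :*
    (P₀ X Y S :* ψ X Y (S :- K) :+ P₁ X Y S :* ψ X Y S
     :+ Q₀ X Y S :* (S :- ν 1 :- ν 2 :* K) :* ψ X Y (S :- K)
     :+ Q₁ X Y S :* (S :- ν 2 :* K) :* ψ X Y S)
  := ψ X Y (S :- K) :* (A X Y S (K :+ ν 1) :+ B X Y S (K :+ ν 1) :* δ X Y K)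
     :- φ X Y (K :+ ν 1) :* K :* A X Y S K) refl

cong₃ : ∀ (f : ℚ → ℚ → ℚ → ℚ) {a b c a′ b′ c′} → a ≡ a′ → b ≡ b′ → c ≡ c′ → f a b c ≡ f a′ b′ c′
cong₃ f refl refl refl = refl

H-suc : ∀ m {M} → fromℕ m ≡ M → H (suc m) *ℚ (M +ℚ 1ℚ) ≡ H m *ℚ (M +ℚ 1ℚ) +ℚ 1ℚ
H-suc m refl = begin
  (H m +ℚ u) *ℚ (fromℕ m +ℚ 1ℚ)                 ≡⟨ ℚ.*-distribʳ-+ (fromℕ m +ℚ 1ℚ) (H m) u ⟩
  H m *ℚ (fromℕ m +ℚ 1ℚ) +ℚ u *ℚ (fromℕ m +ℚ 1ℚ) ≡⟨ cong (λ v → H m *ℚ (fromℕ m +ℚ 1ℚ) +ℚ u *ℚ v) (fromℕ-suc m) ⟨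
  H m *ℚ (fromℕ m +ℚ 1ℚ) +ℚ u *ℚ fromℕ (suc m)   ≡⟨ cong (H m *ℚ (fromℕ m +ℚ 1ℚ) +ℚ_) (÷ℕ-*-denominator 1 (suc m) (s≤s z≤n)) ⟩
  H m *ℚ (fromℕ m +ℚ 1ℚ) +ℚ 1ℚ                   ∎
  where
  open ≡-Reasoning
  u : ℚ
  u = 1 ÷ℕ suc m

weighted-telescoping-step : ∀ (M D Ψ Ψ′ P₀ P₁ a b B B′ t₀ t₁ t₁′ : ℚ) →
  t₀ *ℚ M ≡ t₁ *ℚ D → t₁′ *ℚ Ψ′ ≡ t₁ *ℚ D →
  P₀ *ℚ D *ℚ a +ℚ P₁ *ℚ M *ℚ b ≡ D *ℚ B′ -ℚ Ψ *ℚ B →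
  M *ℚ (P₀ *ℚ (a *ℚ t₀) +ℚ P₁ *ℚ (b *ℚ t₁)) ≡ t₁′ *ℚ (Ψ′ *ℚ B′) -ℚ t₁ *ℚ (Ψ *ℚ B)
weighted-telescoping-step M D Ψ Ψ′ P₀ P₁ a b B B′ t₀ t₁ t₁′ shift-n shift-k certificate = begin
  M *ℚ (P₀ *ℚ (a *ℚ t₀) +ℚ P₁ *ℚ (b *ℚ t₁))   ≡⟨ expose-t₀M M P₀ P₁ a b t₀ t₁ ⟩
  P₀ *ℚ a *ℚ (t₀ *ℚ M) +ℚ t₁ *ℚ (P₁ *ℚ M *ℚ b) ≡⟨ cong (λ u → P₀ *ℚ a *ℚ u +ℚ t₁ *ℚ (P₁ *ℚ M *ℚ b)) shift-n ⟩
  P₀ *ℚ a *ℚ (t₁ *ℚ D) +ℚ t₁ *ℚ (P₁ *ℚ M *ℚ b) ≡⟨ factor-t₁ D P₀ a t₁ (P₁ *ℚ M *ℚ b) ⟩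
  t₁ *ℚ (P₀ *ℚ D *ℚ a +ℚ P₁ *ℚ M *ℚ b)          ≡⟨ cong (t₁ *ℚ_) certificate ⟩
  t₁ *ℚ (D *ℚ B′ -ℚ Ψ *ℚ B)                     ≡⟨ expose-t₁D t₁ D B′ (Ψ *ℚ B) ⟩
  t₁ *ℚ D *ℚ B′ -ℚ t₁ *ℚ (Ψ *ℚ B)               ≡⟨ cong (λ u → u *ℚ B′ -ℚ t₁ *ℚ (Ψ *ℚ B)) shift-k ⟨
  t₁′ *ℚ Ψ′ *ℚ B′ -ℚ t₁ *ℚ (Ψ *ℚ B)             ≡⟨ cong (_-ℚ t₁ *ℚ (Ψ *ℚ B)) (ℚ.*-assoc t₁′ Ψ′ B′) ⟩
  t₁′ *ℚ (Ψ′ *ℚ B′) -ℚ t₁ *ℚ (Ψ *ℚ B)           ∎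
  where
  open ≡-Reasoning
  expose-t₀M : ∀ M P₀ P₁ a b t₀ t₁ →
    M *ℚ (P₀ *ℚ (a *ℚ t₀) +ℚ P₁ *ℚ (b *ℚ t₁)) ≡ P₀ *ℚ a *ℚ (t₀ *ℚ M) +ℚ t₁ *ℚ (P₁ *ℚ M *ℚ b)
  expose-t₀M = solve 7 (λ M P₀ P₁ a b t₀ t₁ →
    M :* (P₀ :* (a :* t₀) :+ P₁ :* (b :* t₁)) := P₀ :* a :* (t₀ :* M) :+ t₁ :* (P₁ :* M :* b)) refl
  factor-t₁ : ∀ D P₀ a t₁ u → P₀ *ℚ a *ℚ (t₁ *ℚ D) +ℚ t₁ *ℚ u ≡ t₁ *ℚ (P₀ *ℚ D *ℚ a +ℚ u)
  factor-t₁ = solve 5 (λ D P₀ a t₁ u → P₀ :* a :* (t₁ :* D) :+ t₁ :* u := t₁ :* (P₀ :* D :* a :+ u)) refl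
  expose-t₁D : ∀ t₁ D B′ v → t₁ *ℚ (D *ℚ B′ -ℚ v) ≡ t₁ *ℚ D *ℚ B′ -ℚ t₁ *ℚ v
  expose-t₁D = solve 4 (λ t₁ D B′ v → t₁ :* (D :* B′ :- v) := t₁ :* D :* B′ :- t₁ :* v) refl

-- Both sides carry the factor Φ = φ(k+1), the denominator of h(k+1) − h(k).
rational-telescoping-step : ∀ (M D Φ K K₁ P₀ P₁ Q₀ Q₁ a b A A′ B′ Δ h h′ t₀ t₁ t₁′ : ℚ) →
  t₀ *ℚ M ≡ t₁ *ℚ D → t₁′ *ℚ (K₁ *ℚ Φ) ≡ t₁ *ℚ D → h′ *ℚ Φ ≡ h *ℚ Φ +ℚ Δ →
  Φ *ℚ (P₀ *ℚ D +ℚ P₁ *ℚ M +ℚ Q₀ *ℚ a *ℚ D +ℚ Q₁ *ℚ b *ℚ M) ≡ D *ℚ (A′ +ℚ B′ *ℚ Δ) -ℚ Φ *ℚ K *ℚ A →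
  Φ *ℚ (M *ℚ (P₀ *ℚ t₀ +ℚ P₁ *ℚ t₁ +ℚ (Q₀ *ℚ (a *ℚ t₀) +ℚ Q₁ *ℚ (b *ℚ t₁))))
    ≡ Φ *ℚ (t₁′ *ℚ (K₁ *ℚ A′) -ℚ t₁ *ℚ (K *ℚ A) +ℚ (h′ -ℚ h) *ℚ (t₁′ *ℚ (K₁ *ℚ Φ *ℚ B′)))
rational-telescoping-step M D Φ K K₁ P₀ P₁ Q₀ Q₁ a b A A′ B′ Δ h h′ t₀ t₁ t₁′
                          shift-n shift-k harmonic-shift certificate = begin
  Φ *ℚ (M *ℚ (P₀ *ℚ t₀ +ℚ P₁ *ℚ t₁ +ℚ (Q₀ *ℚ (a *ℚ t₀) +ℚ Q₁ *ℚ (b *ℚ t₁))))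
    ≡⟨ expose-t₀M Φ M P₀ P₁ Q₀ Q₁ a b t₀ t₁ ⟩
  Φ *ℚ ((P₀ +ℚ Q₀ *ℚ a) *ℚ (t₀ *ℚ M) +ℚ (P₁ +ℚ Q₁ *ℚ b) *ℚ M *ℚ t₁)
    ≡⟨ cong (λ u → Φ *ℚ ((P₀ +ℚ Q₀ *ℚ a) *ℚ u +ℚ (P₁ +ℚ Q₁ *ℚ b) *ℚ M *ℚ t₁)) shift-n ⟩
  Φ *ℚ ((P₀ +ℚ Q₀ *ℚ a) *ℚ (t₁ *ℚ D) +ℚ (P₁ +ℚ Q₁ *ℚ b) *ℚ M *ℚ t₁)
    ≡⟨ factor-t₁ Φ M D P₀ P₁ Q₀ Q₁ a b t₁ ⟩
  t₁ *ℚ (Φ *ℚ (P₀ *ℚ D +ℚ P₁ *ℚ M +ℚ Q₀ *ℚ a *ℚ D +ℚ Q₁ *ℚ b *ℚ M))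
    ≡⟨ cong (t₁ *ℚ_) certificate ⟩
  t₁ *ℚ (D *ℚ (A′ +ℚ B′ *ℚ Δ) -ℚ Φ *ℚ K *ℚ A)
    ≡⟨ expose-t₁D t₁ D Φ K A (A′ +ℚ B′ *ℚ Δ) ⟩
  t₁ *ℚ D *ℚ (A′ +ℚ B′ *ℚ Δ) -ℚ Φ *ℚ (t₁ *ℚ (K *ℚ A))
    ≡⟨ cong (λ u → u *ℚ (A′ +ℚ B′ *ℚ Δ) -ℚ Φ *ℚ (t₁ *ℚ (K *ℚ A))) shift-k ⟨
  t₁′ *ℚ (K₁ *ℚ Φ) *ℚ (A′ +ℚ B′ *ℚ Δ) -ℚ Φ *ℚ (t₁ *ℚ (K *ℚ A))
    ≡⟨ cong (λ u → t₁′ *ℚ (K₁ *ℚ Φ) *ℚ (A′ +ℚ B′ *ℚ u) -ℚ Φ *ℚ (t₁ *ℚ (K *ℚ A))) Δ≡ ⟩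
  t₁′ *ℚ (K₁ *ℚ Φ) *ℚ (A′ +ℚ B′ *ℚ (h′ *ℚ Φ -ℚ h *ℚ Φ)) -ℚ Φ *ℚ (t₁ *ℚ (K *ℚ A))
    ≡⟨ factor-Φ Φ K₁ A′ B′ h h′ t₁′ (t₁ *ℚ (K *ℚ A)) ⟩
  Φ *ℚ (t₁′ *ℚ (K₁ *ℚ A′) -ℚ t₁ *ℚ (K *ℚ A) +ℚ (h′ -ℚ h) *ℚ (t₁′ *ℚ (K₁ *ℚ Φ *ℚ B′)))
    ∎
  where
  open ≡-Reasoning
  Δ≡ : Δ ≡ h′ *ℚ Φ -ℚ h *ℚ Φ
  Δ≡ = trans (solve 2 (λ u Δ → Δ := u :+ Δ :- u) refl (h *ℚ Φ) Δ) (cong (_-ℚ h *ℚ Φ) (sym harmonic-shift))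
  expose-t₀M : ∀ Φ M P₀ P₁ Q₀ Q₁ a b t₀ t₁ →
    Φ *ℚ (M *ℚ (P₀ *ℚ t₀ +ℚ P₁ *ℚ t₁ +ℚ (Q₀ *ℚ (a *ℚ t₀) +ℚ Q₁ *ℚ (b *ℚ t₁))))
    ≡ Φ *ℚ ((P₀ +ℚ Q₀ *ℚ a) *ℚ (t₀ *ℚ M) +ℚ (P₁ +ℚ Q₁ *ℚ b) *ℚ M *ℚ t₁)
  expose-t₀M = solve 10 (λ Φ M P₀ P₁ Q₀ Q₁ a b t₀ t₁ →
    Φ :* (M :* (P₀ :* t₀ :+ P₁ :* t₁ :+ (Q₀ :* (a :* t₀) :+ Q₁ :* (b :* t₁))))
    := Φ :* ((P₀ :+ Q₀ :* a) :* (t₀ :* M) :+ (P₁ :+ Q₁ :* b) :* M :* t₁)) refl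
  factor-t₁ : ∀ Φ M D P₀ P₁ Q₀ Q₁ a b t₁ →
    Φ *ℚ ((P₀ +ℚ Q₀ *ℚ a) *ℚ (t₁ *ℚ D) +ℚ (P₁ +ℚ Q₁ *ℚ b) *ℚ M *ℚ t₁)
    ≡ t₁ *ℚ (Φ *ℚ (P₀ *ℚ D +ℚ P₁ *ℚ M +ℚ Q₀ *ℚ a *ℚ D +ℚ Q₁ *ℚ b *ℚ M))
  factor-t₁ = solve 10 (λ Φ M D P₀ P₁ Q₀ Q₁ a b t₁ →
    Φ :* ((P₀ :+ Q₀ :* a) :* (t₁ :* D) :+ (P₁ :+ Q₁ :* b) :* M :* t₁)
    := t₁ :* (Φ :* (P₀ :* D :+ P₁ :* M :+ Q₀ :* a :* D :+ Q₁ :* b :* M))) refl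
  expose-t₁D : ∀ t₁ D Φ K A v → t₁ *ℚ (D *ℚ v -ℚ Φ *ℚ K *ℚ A) ≡ t₁ *ℚ D *ℚ v -ℚ Φ *ℚ (t₁ *ℚ (K *ℚ A))
  expose-t₁D = solve 6 (λ t₁ D Φ K A v → t₁ :* (D :* v :- Φ :* K :* A) := t₁ :* D :* v :- Φ :* (t₁ :* (K :* A))) refl
  factor-Φ : ∀ Φ K₁ A′ B′ h h′ t₁′ w →
    t₁′ *ℚ (K₁ *ℚ Φ) *ℚ (A′ +ℚ B′ *ℚ (h′ *ℚ Φ -ℚ h *ℚ Φ)) -ℚ Φ *ℚ w
    ≡ Φ *ℚ (t₁′ *ℚ (K₁ *ℚ A′) -ℚ w +ℚ (h′ -ℚ h) *ℚ (t₁′ *ℚ (K₁ *ℚ Φ *ℚ B′)))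
  factor-Φ = solve 8 (λ Φ K₁ A′ B′ h h′ t₁′ w →
    t₁′ :* (K₁ :* Φ) :* (A′ :+ B′ :* (h′ :* Φ :- h :* Φ)) :- Φ :* w
    := Φ :* (t₁′ :* (K₁ :* A′) :- w :+ (h′ :- h) :* (t₁′ :* (K₁ :* Φ :* B′)))) refl

telescoping-step : ∀ (M P₀ P₁ Q₀ Q₁ a b h t₀ t₁ R G G′ : ℚ) →
  M *ℚ (P₀ *ℚ t₀ +ℚ P₁ *ℚ t₁ +ℚ (Q₀ *ℚ (a *ℚ t₀) +ℚ Q₁ *ℚ (b *ℚ t₁))) ≡ R →
  M *ℚ (P₀ *ℚ (a *ℚ t₀) +ℚ P₁ *ℚ (b *ℚ t₁)) ≡ G′ -ℚ G →
  M *ℚ (P₀ *ℚ (t₀ *ℚ (1ℚ +ℚ a *ℚ h)) +ℚ P₁ *ℚ (t₁ *ℚ (1ℚ +ℚ b *ℚ h)) +ℚ (Q₀ *ℚ (a *ℚ t₀) +ℚ Q₁ *ℚ (b *ℚ t₁)))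
    ≡ R +ℚ h *ℚ (G′ -ℚ G)
telescoping-step M P₀ P₁ Q₀ Q₁ a b h t₀ t₁ R G G′ rational weighted =
  trans (split M P₀ P₁ Q₀ Q₁ a b h t₀ t₁) (cong₂ (λ u v → u +ℚ h *ℚ v) rational weighted)
  where
  split : ∀ M P₀ P₁ Q₀ Q₁ a b h t₀ t₁ →
    M *ℚ (P₀ *ℚ (t₀ *ℚ (1ℚ +ℚ a *ℚ h)) +ℚ P₁ *ℚ (t₁ *ℚ (1ℚ +ℚ b *ℚ h)) +ℚ (Q₀ *ℚ (a *ℚ t₀) +ℚ Q₁ *ℚ (b *ℚ t₁)))
    ≡ M *ℚ (P₀ *ℚ t₀ +ℚ P₁ *ℚ t₁ +ℚ (Q₀ *ℚ (a *ℚ t₀) +ℚ Q₁ *ℚ (b *ℚ t₁)))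
      +ℚ h *ℚ (M *ℚ (P₀ *ℚ (a *ℚ t₀) +ℚ P₁ *ℚ (b *ℚ t₁)))
  split = solve 10 (λ M P₀ P₁ Q₀ Q₁ a b h t₀ t₁ →
    M :* (P₀ :* (t₀ :* (ν 1 :+ a :* h)) :+ P₁ :* (t₁ :* (ν 1 :+ b :* h)) :+ (Q₀ :* (a :* t₀) :+ Q₁ :* (b :* t₁)))
    := M :* (P₀ :* t₀ :+ P₁ :* t₁ :+ (Q₀ :* (a :* t₀) :+ Q₁ :* (b :* t₁)))
       :+ h :* (M :* (P₀ :* (a :* t₀) :+ P₁ :* (b :* t₁)))) refl

+-extend : ∀ {k j m} z → k + j ≡ m → k + (j + z) ≡ m + z
+-extend {k} {j} z k+j≡m = trans (sym (ℕ.+-assoc k j z)) (cong (_+ z) k+j≡m)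

module _ (x y : ℕ) where

  X Y : ℚ
  X = fromℕ x
  Y = fromℕ y

  φℕ ψℕ : ℕ → ℕ
  φℕ z = z * (z + x) * (z + y)
  ψℕ z = z * φℕ z

  fromℕ-φ : ∀ z → fromℕ (φℕ z) ≡ ⟦ φ ⟧₃ X Y (fromℕ z)
  fromℕ-φ z = fromℕ-⟦⟧ (⌜ z ⌝ ⊗ (⌜ z ⌝ ⊕ ⌜ x ⌝) ⊗ (⌜ z ⌝ ⊕ ⌜ y ⌝))

  fromℕ-ψ : ∀ z → fromℕ (ψℕ z) ≡ ⟦ ψ ⟧₃ X Y (fromℕ z)
  fromℕ-ψ z = fromℕ-⟦⟧ (⌜ z ⌝ ⊗ (⌜ z ⌝ ⊗ (⌜ z ⌝ ⊕ ⌜ x ⌝) ⊗ (⌜ z ⌝ ⊕ ⌜ y ⌝)))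

  numerator : ℕ → ℕ → ℕ
  numerator n k = (n C k) * (n C k) * ((n + x) C k) * ((n + y) C k)

  denominator : ℕ → ℕ
  denominator k = ((k + x) C k) * ((k + y) C k)

  denominator-pos : ∀ k → 0 < denominator k
  denominator-pos k = ℕ.*-mono-< (C-pos (ℕ.m≤m+n k x)) (C-pos (ℕ.m≤m+n k y))

  numerator-suc-n : ∀ {n} k j → k + j ≡ suc n → numerator n k * ψℕ (suc n) ≡ numerator (suc n) k * ψℕ j
  numerator-suc-n {n} k j k+j≡s = begin
    numerator n k * ψℕ s                                    ≡⟨ regroup c cx cy s (s + x) (s + y) ⟩
    (s * c) * (s * c) * ((s + x) * cx) * ((s + y) * cy)     ≡⟨ cong₂ (λ u v → u * u * v * ((s + y) * cy)) shift shiftˣ ⟨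
    (C₀ * j) * (C₀ * j) * (Cˣ * (j + x)) * ((s + y) * cy)   ≡⟨ cong ((C₀ * j) * (C₀ * j) * (Cˣ * (j + x)) *_) shiftʸ ⟨
    (C₀ * j) * (C₀ * j) * (Cˣ * (j + x)) * (Cʸ * (j + y))   ≡⟨ regroup′ C₀ Cˣ Cʸ j (j + x) (j + y) ⟨
    numerator s k * ψℕ j                                    ∎
    where
    open ≡-Reasoning
    s c cx cy C₀ Cˣ Cʸ : ℕ
    s = suc n
    c = n C k
    cx = (n + x) C k
    cy = (n + y) C k
    C₀ = s C k
    Cˣ = (s + x) C k
    Cʸ = (s + y) C k
    shift : C₀ * j ≡ s * c
    shift = C-shift k j k+j≡s
    shiftˣ : Cˣ * (j + x) ≡ (s + x) * cx
    shiftˣ = C-shift k (j + x) (+-extend {k} x k+j≡s)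
    shiftʸ : Cʸ * (j + y) ≡ (s + y) * cy
    shiftʸ = C-shift k (j + y) (+-extend {k} y k+j≡s)
    regroup : ∀ a b c p q r → a * a * b * c * (p * (p * q * r)) ≡ (p * a) * (p * a) * (q * b) * (r * c)
    regroup = solve-∀
    regroup′ : ∀ a b c p q r → a * a * b * c * (p * (p * q * r)) ≡ (a * p) * (a * p) * (b * q) * (c * r)
    regroup′ = solve-∀

  numerator-suc-k : ∀ {m} k j → k + j ≡ m →
                    numerator m (suc k) * (suc k * suc k * suc k * suc k) ≡ numerator m k * ψℕ j
  numerator-suc-k {m} k j k+j≡m = begin
    numerator m (suc k) * (k₁ * k₁ * k₁ * k₁)                          ≡⟨ regroup C₀ Cˣ Cʸ k₁ ⟩
    (C₀ * k₁) * (C₀ * k₁) * (Cˣ * k₁) * (Cʸ * k₁)                      ≡⟨ cong₂ (λ u v → u * u * v * (Cʸ * k₁)) down downˣ ⟩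
    (j * c) * (j * c) * ((j + x) * cx) * (Cʸ * k₁)                     ≡⟨ cong ((j * c) * (j * c) * ((j + x) * cx) *_) downʸ ⟩
    (j * c) * (j * c) * ((j + x) * cx) * ((j + y) * cy)                ≡⟨ regroup′ c cx cy j (j + x) (j + y) ⟩
    numerator m k * ψℕ j                                               ∎
    where
    open ≡-Reasoning
    k₁ c cx cy C₀ Cˣ Cʸ : ℕ
    k₁ = suc k
    c = m C k
    cx = (m + x) C k
    cy = (m + y) C k
    C₀ = m C k₁
    Cˣ = (m + x) C k₁
    Cʸ = (m + y) C k₁
    down : C₀ * k₁ ≡ j * c
    down = C-down k j k+j≡m
    downˣ : Cˣ * k₁ ≡ (j + x) * cx
    downˣ = C-down k (j + x) (+-extend {k} x k+j≡m)
    downʸ : Cʸ * k₁ ≡ (j + y) * cy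
    downʸ = C-down k (j + y) (+-extend {k} y k+j≡m)
    regroup : ∀ a b c p → a * a * b * c * (p * p * p * p) ≡ (a * p) * (a * p) * (b * p) * (c * p)
    regroup = solve-∀
    regroup′ : ∀ a b c p q r → (p * a) * (p * a) * (q * b) * (r * c) ≡ a * a * b * c * (p * (p * q * r))
    regroup′ = solve-∀

  denominator-suc : ∀ k → denominator (suc k) * (suc k * suc k) ≡ denominator k * ((suc k + x) * (suc k + y))
  denominator-suc k = begin
    denominator (suc k) * (k₁ * k₁)                           ≡⟨ regroup Cˣ Cʸ k₁ ⟩
    (k₁ * Cˣ) * (k₁ * Cʸ)                                     ≡⟨ cong₂ _*_ (C-absorb (k + x) k) (C-absorb (k + y) k) ⟩
    (suc (k + x) * cx) * (suc (k + y) * cy)                   ≡⟨ regroup′ cx cy (suc (k + x)) (suc (k + y)) ⟩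
    denominator k * ((suc k + x) * (suc k + y))               ∎
    where
    open ≡-Reasoning
    k₁ cx cy Cˣ Cʸ : ℕ
    k₁ = suc k
    cx = (k + x) C k
    cy = (k + y) C k
    Cˣ = (k₁ + x) C k₁
    Cʸ = (k₁ + y) C k₁
    regroup : ∀ a b p → a * b * (p * p) ≡ (p * a) * (p * b)
    regroup = solve-∀
    regroup′ : ∀ a b p q → (p * a) * (q * b) ≡ a * b * (p * q)
    regroup′ = solve-∀

  term : ℕ → ℕ → ℚ
  term n k = numerator n k ÷ℕ denominator k

  term-suc-n : ∀ {n} k j → k + j ≡ suc n → term n k *ℚ fromℕ (ψℕ (suc n)) ≡ term (suc n) k *ℚ fromℕ (ψℕ j)
  term-suc-n {n} k j k+j≡s = ÷ℕ-*-cross _ _ (denominator-pos k) (denominator-pos k) (begin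
    numerator n k * d * ψℕ (suc n)   ≡⟨ swap (numerator n k) d (ψℕ (suc n)) ⟩
    numerator n k * ψℕ (suc n) * d   ≡⟨ cong (_* d) (numerator-suc-n k j k+j≡s) ⟩
    numerator (suc n) k * ψℕ j * d   ≡⟨ swap (numerator (suc n) k) d (ψℕ j) ⟨
    numerator (suc n) k * d * ψℕ j   ∎)
    where
    open ≡-Reasoning
    d : ℕ
    d = denominator k
    swap : ∀ a b c → a * b * c ≡ a * c * b
    swap = solve-∀

  term-suc-k : ∀ {m} k j → k + j ≡ m → term m (suc k) *ℚ fromℕ (ψℕ (suc k)) ≡ term m k *ℚ fromℕ (ψℕ j)
  term-suc-k {m} k j k+j≡m = ÷ℕ-*-cross _ _ (denominator-pos (suc k)) (denominator-pos k)
    (ℕ.*-cancelʳ-≡ _ _ (k₁ * k₁) (begin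
      a₁ * d₀ * ψℕ k₁ * (k₁ * k₁)                                ≡⟨ regroup a₁ d₀ k₁ (k₁ + x) (k₁ + y) ⟩
      a₁ * (k₁ * k₁ * k₁ * k₁) * (d₀ * ((k₁ + x) * (k₁ + y)))    ≡⟨ cong₂ _*_ (numerator-suc-k k j k+j≡m) (sym (denominator-suc k)) ⟩
      a₀ * ψℕ j * (d₁ * (k₁ * k₁))                              ≡⟨ regroup′ a₀ (ψℕ j) d₁ (k₁ * k₁) ⟩
      a₀ * d₁ * ψℕ j * (k₁ * k₁)                                ∎))
    where
    open ≡-Reasoning
    k₁ a₀ a₁ d₀ d₁ : ℕ
    k₁ = suc k
    a₀ = numerator m k
    a₁ = numerator m k₁
    d₀ = denominator k
    d₁ = denominator k₁
    regroup : ∀ a d p q r → a * d * (p * (p * q * r)) * (p * p) ≡ a * (p * p * p * p) * (d * (q * r))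
    regroup = solve-∀
    regroup′ : ∀ a e d q → a * e * (d * q) ≡ a * d * e * q
    regroup′ = solve-∀

  harmonic : ℕ → ℚ
  harmonic k = fromℕ 2 *ℚ H k +ℚ H (x + k) +ℚ H (y + k)

  harmonic-suc : ∀ k → let K = fromℕ k in
    harmonic (suc k) *ℚ ⟦ φ ⟧₃ X Y (K +ℚ 1ℚ) ≡ harmonic k *ℚ ⟦ φ ⟧₃ X Y (K +ℚ 1ℚ) +ℚ ⟦ δ ⟧₃ X Y K
  harmonic-suc k = begin
    harmonic (suc k) *ℚ Φ
      ≡⟨ cong₂ (λ u v → (fromℕ 2 *ℚ H (suc k) +ℚ H u +ℚ H v) *ℚ Φ) (ℕ.+-suc x k) (ℕ.+-suc y k) ⟩
    (fromℕ 2 *ℚ H (suc k) +ℚ H (suc (x + k)) +ℚ H (suc (y + k))) *ℚ Φ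
      ≡⟨ distribute (H (suc k)) (H (suc (x + k))) (H (suc (y + k))) X Y K ⟩
    E (H (suc k) *ℚ (K +ℚ 1ℚ)) (H (suc (x + k)) *ℚ (X +ℚ K +ℚ 1ℚ)) (H (suc (y + k)) *ℚ (Y +ℚ K +ℚ 1ℚ))
      ≡⟨ cong₃ E (H-suc k refl) (H-suc (x + k) (fromℕ-+ x k)) (H-suc (y + k) (fromℕ-+ y k)) ⟩
    E (H k *ℚ (K +ℚ 1ℚ) +ℚ 1ℚ) (H (x + k) *ℚ (X +ℚ K +ℚ 1ℚ) +ℚ 1ℚ) (H (y + k) *ℚ (Y +ℚ K +ℚ 1ℚ) +ℚ 1ℚ)
      ≡⟨ collect (H k) (H (x + k)) (H (y + k)) X Y K ⟩
    harmonic k *ℚ Φ +ℚ ⟦ δ ⟧₃ X Y K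
      ∎
    where
    open ≡-Reasoning
    K Φ : ℚ
    K = fromℕ k
    Φ = ⟦ φ ⟧₃ X Y (K +ℚ 1ℚ)
    E : ℚ → ℚ → ℚ → ℚ
    E p q r = fromℕ 2 *ℚ p *ℚ (K +ℚ 1ℚ +ℚ X) *ℚ (K +ℚ 1ℚ +ℚ Y) +ℚ q *ℚ (K +ℚ 1ℚ) *ℚ (K +ℚ 1ℚ +ℚ Y)
              +ℚ r *ℚ (K +ℚ 1ℚ) *ℚ (K +ℚ 1ℚ +ℚ X)
    distribute : ∀ a b c X Y K →
      (fromℕ 2 *ℚ a +ℚ b +ℚ c) *ℚ ⟦ φ ⟧₃ X Y (K +ℚ 1ℚ)
      ≡ fromℕ 2 *ℚ (a *ℚ (K +ℚ 1ℚ)) *ℚ (K +ℚ 1ℚ +ℚ X) *ℚ (K +ℚ 1ℚ +ℚ Y)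
        +ℚ b *ℚ (X +ℚ K +ℚ 1ℚ) *ℚ (K +ℚ 1ℚ) *ℚ (K +ℚ 1ℚ +ℚ Y)
        +ℚ c *ℚ (Y +ℚ K +ℚ 1ℚ) *ℚ (K +ℚ 1ℚ) *ℚ (K +ℚ 1ℚ +ℚ X)
    distribute = solve 6 (λ a b c X Y K →
      (ν 2 :* a :+ b :+ c) :* φ X Y (K :+ ν 1)
      := ν 2 :* (a :* (K :+ ν 1)) :* (K :+ ν 1 :+ X) :* (K :+ ν 1 :+ Y)
         :+ b :* (X :+ K :+ ν 1) :* (K :+ ν 1) :* (K :+ ν 1 :+ Y)
         :+ c :* (Y :+ K :+ ν 1) :* (K :+ ν 1) :* (K :+ ν 1 :+ X)) refl
    collect : ∀ a b c X Y K →
      fromℕ 2 *ℚ (a *ℚ (K +ℚ 1ℚ) +ℚ 1ℚ) *ℚ (K +ℚ 1ℚ +ℚ X) *ℚ (K +ℚ 1ℚ +ℚ Y)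
        +ℚ (b *ℚ (X +ℚ K +ℚ 1ℚ) +ℚ 1ℚ) *ℚ (K +ℚ 1ℚ) *ℚ (K +ℚ 1ℚ +ℚ Y)
        +ℚ (c *ℚ (Y +ℚ K +ℚ 1ℚ) +ℚ 1ℚ) *ℚ (K +ℚ 1ℚ) *ℚ (K +ℚ 1ℚ +ℚ X)
      ≡ (fromℕ 2 *ℚ a +ℚ b +ℚ c) *ℚ ⟦ φ ⟧₃ X Y (K +ℚ 1ℚ) +ℚ ⟦ δ ⟧₃ X Y K
    collect = solve 6 (λ a b c X Y K →
      ν 2 :* (a :* (K :+ ν 1) :+ ν 1) :* (K :+ ν 1 :+ X) :* (K :+ ν 1 :+ Y)
        :+ (b :* (X :+ K :+ ν 1) :+ ν 1) :* (K :+ ν 1) :* (K :+ ν 1 :+ Y)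
        :+ (c :* (Y :+ K :+ ν 1) :+ ν 1) :* (K :+ ν 1) :* (K :+ ν 1 :+ X)
      := (ν 2 :* a :+ b :+ c) :* φ X Y (K :+ ν 1) :+ δ X Y K) refl

  weight : ℕ → ℕ → ℚ
  weight n k = fromℕ n -ℚ fromℕ (2 * k)

  summand weighted : ℕ → ℕ → ℚ
  summand n k = term n k *ℚ (1ℚ +ℚ weight n k *ℚ harmonic k)
  weighted    n k = weight n k *ℚ term n k

  module _ (n : ℕ) where

    S : ℚ
    S = fromℕ (suc n)

    weighted-antidifference antidifference : ℕ → ℚ
    weighted-antidifference k = term (suc n) k *ℚ (⟦ ψ ⟧₃ X Y K *ℚ ⟦ B ⟧₄ X Y S K)
      where
      K : ℚ
      K = fromℕ k
    antidifference k = term (suc n) k *ℚ (K *ℚ ⟦ A ⟧₄ X Y S K) +ℚ harmonic k *ℚ weighted-antidifference k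
      where
      K : ℚ
      K = fromℕ k

    weighted-combination summand-combination : ℕ → ℚ
    weighted-combination k = ⟦ P₀ ⟧₃ X Y S *ℚ weighted n k +ℚ ⟦ P₁ ⟧₃ X Y S *ℚ weighted (suc n) k
    summand-combination k =
      ⟦ P₀ ⟧₃ X Y S *ℚ summand n k +ℚ ⟦ P₁ ⟧₃ X Y S *ℚ summand (suc n) k
      +ℚ (⟦ Q₀ ⟧₃ X Y S *ℚ weighted n k +ℚ ⟦ Q₁ ⟧₃ X Y S *ℚ weighted (suc n) k)

    module _ (k : ℕ) (k≤s : k ≤ suc n) where

      private
        K K₁ M D Ψ Ψ′ Φ′ p₀ p₁ q₀ q₁ Aₖ Aₖ₊₁ Bₖ Bₖ₊₁ a b t₀ t₁ t₁′ : ℚ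
        K    = fromℕ k
        K₁   = K +ℚ 1ℚ
        M    = ⟦ ψ ⟧₃ X Y S
        D    = ⟦ ψ ⟧₃ X Y (S -ℚ K)
        Ψ    = ⟦ ψ ⟧₃ X Y K
        Ψ′   = ⟦ ψ ⟧₃ X Y K₁
        Φ′   = ⟦ φ ⟧₃ X Y K₁
        p₀   = ⟦ P₀ ⟧₃ X Y S
        p₁   = ⟦ P₁ ⟧₃ X Y S
        q₀   = ⟦ Q₀ ⟧₃ X Y S
        q₁   = ⟦ Q₁ ⟧₃ X Y S
        Aₖ   = ⟦ A ⟧₄ X Y S K
        Aₖ₊₁ = ⟦ A ⟧₄ X Y S K₁
        Bₖ   = ⟦ B ⟧₄ X Y S K
        Bₖ₊₁ = ⟦ B ⟧₄ X Y S K₁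
        a   = S -ℚ 1ℚ -ℚ fromℕ 2 *ℚ K
        b   = S -ℚ fromℕ 2 *ℚ K
        t₀  = term n k
        t₁  = term (suc n) k
        t₁′ = term (suc n) (suc k)
        j : ℕ
        j = suc n ∸ k
        k+j≡s : k + j ≡ suc n
        k+j≡s = ℕ.m+[n∸m]≡n k≤s
        fromℕ-ψj : fromℕ (ψℕ j) ≡ D
        fromℕ-ψj = trans (fromℕ-ψ j) (cong (⟦ ψ ⟧₃ X Y) (fromℕ-∸ (suc n) k k≤s))

      term-shift-n : t₀ *ℚ M ≡ t₁ *ℚ D
      term-shift-n = begin
        t₀ *ℚ M                    ≡⟨ cong (t₀ *ℚ_) (fromℕ-ψ (suc n)) ⟨
        t₀ *ℚ fromℕ (ψℕ (suc n))   ≡⟨ term-suc-n k j k+j≡s ⟩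
        t₁ *ℚ fromℕ (ψℕ j)         ≡⟨ cong (t₁ *ℚ_) fromℕ-ψj ⟩
        t₁ *ℚ D                    ∎
        where open ≡-Reasoning

      term-shift-k : t₁′ *ℚ ⟦ ψ ⟧₃ X Y K₁ ≡ t₁ *ℚ D
      term-shift-k = begin
        t₁′ *ℚ ⟦ ψ ⟧₃ X Y K₁          ≡⟨ cong (λ Z → t₁′ *ℚ ⟦ ψ ⟧₃ X Y Z) (fromℕ-suc k) ⟨
        t₁′ *ℚ ⟦ ψ ⟧₃ X Y (fromℕ (suc k)) ≡⟨ cong (t₁′ *ℚ_) (fromℕ-ψ (suc k)) ⟨
        t₁′ *ℚ fromℕ (ψℕ (suc k))     ≡⟨ term-suc-k k j k+j≡s ⟩
        t₁ *ℚ fromℕ (ψℕ j)            ≡⟨ cong (t₁ *ℚ_) fromℕ-ψj ⟩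
        t₁ *ℚ D                       ∎
        where open ≡-Reasoning

      weight-n : weight n k ≡ a
      weight-n = cong₂ _-ℚ_ (fromℕ-∸ (suc n) 1 (s≤s z≤n)) (fromℕ-* 2 k)

      weight-s : weight (suc n) k ≡ b
      weight-s = cong (S -ℚ_) (fromℕ-* 2 k)

      weighted-telescopes′ : M *ℚ (p₀ *ℚ (a *ℚ t₀) +ℚ p₁ *ℚ (b *ℚ t₁)) ≡ t₁′ *ℚ (Ψ′ *ℚ Bₖ₊₁) -ℚ weighted-antidifference k
      weighted-telescopes′ = weighted-telescoping-step M D Ψ Ψ′ p₀ p₁ a b Bₖ Bₖ₊₁ t₀ t₁ t₁′ term-shift-n term-shift-k (certificate-Z X Y S K)

      weighted-telescopes : M *ℚ weighted-combination k ≡ weighted-antidifference (suc k) -ℚ weighted-antidifference k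
      weighted-telescopes = begin
        M *ℚ weighted-combination k
          ≡⟨ cong₂ (λ u v → M *ℚ (p₀ *ℚ (u *ℚ t₀) +ℚ p₁ *ℚ (v *ℚ t₁))) weight-n weight-s ⟩
        M *ℚ (p₀ *ℚ (a *ℚ t₀) +ℚ p₁ *ℚ (b *ℚ t₁))
          ≡⟨ weighted-telescopes′ ⟩
        t₁′ *ℚ (Ψ′ *ℚ Bₖ₊₁) -ℚ weighted-antidifference k
          ≡⟨ cong (λ Z → t₁′ *ℚ (⟦ ψ ⟧₃ X Y Z *ℚ ⟦ B ⟧₄ X Y S Z) -ℚ weighted-antidifference k) (fromℕ-suc k) ⟨
        weighted-antidifference (suc k) -ℚ weighted-antidifference k
          ∎
        where open ≡-Reasoning

      summand-telescopes : M *ℚ summand-combination k ≡ antidifference (suc k) -ℚ antidifference k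
      summand-telescopes = begin
        M *ℚ summand-combination k
          ≡⟨ cong₂ (λ u v → M *ℚ (p₀ *ℚ (t₀ *ℚ (1ℚ +ℚ u *ℚ h)) +ℚ p₁ *ℚ (t₁ *ℚ (1ℚ +ℚ v *ℚ h))
                                  +ℚ (q₀ *ℚ (u *ℚ t₀) +ℚ q₁ *ℚ (v *ℚ t₁)))) weight-n weight-s ⟩
        M *ℚ (p₀ *ℚ (t₀ *ℚ (1ℚ +ℚ a *ℚ h)) +ℚ p₁ *ℚ (t₁ *ℚ (1ℚ +ℚ b *ℚ h)) +ℚ (q₀ *ℚ (a *ℚ t₀) +ℚ q₁ *ℚ (b *ℚ t₁)))
          ≡⟨ telescoping-step M p₀ p₁ q₀ q₁ a b h t₀ t₁ R (weighted-antidifference k) G′ rational weighted-telescopes′ ⟩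
        R +ℚ h *ℚ (G′ -ℚ weighted-antidifference k)
          ≡⟨ regroup (t₁′ *ℚ (K₁ *ℚ Aₖ₊₁)) (t₁ *ℚ (K *ℚ Aₖ)) h h′ (weighted-antidifference k) G′ ⟩
        (t₁′ *ℚ (K₁ *ℚ Aₖ₊₁) +ℚ h′ *ℚ G′) -ℚ antidifference k
          ≡⟨ cong (λ Z → t₁′ *ℚ (Z *ℚ ⟦ A ⟧₄ X Y S Z) +ℚ h′ *ℚ (t₁′ *ℚ (⟦ ψ ⟧₃ X Y Z *ℚ ⟦ B ⟧₄ X Y S Z))
                         -ℚ antidifference k) (fromℕ-suc k) ⟨
        antidifference (suc k) -ℚ antidifference k
          ∎
        where
        open ≡-Reasoning
        h h′ G′ R : ℚ
        h  = harmonic k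
        h′ = harmonic (suc k)
        G′ = t₁′ *ℚ (Ψ′ *ℚ Bₖ₊₁)
        R  = t₁′ *ℚ (K₁ *ℚ Aₖ₊₁) -ℚ t₁ *ℚ (K *ℚ Aₖ) +ℚ (h′ -ℚ h) *ℚ G′
        fromℕ-φ₁ : fromℕ (φℕ (suc k)) ≡ Φ′
        fromℕ-φ₁ = trans (fromℕ-φ (suc k)) (cong (⟦ φ ⟧₃ X Y) (fromℕ-suc k))
        ρ : ℚ
        ρ  = p₀ *ℚ t₀ +ℚ p₁ *ℚ t₁ +ℚ (q₀ *ℚ (a *ℚ t₀) +ℚ q₁ *ℚ (b *ℚ t₁))
        rational : M *ℚ ρ ≡ R
        rational = *-cancelˡ-fromℕ {φℕ (suc k)} (M *ℚ ρ) R (s≤s z≤n) (begin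
          fromℕ (φℕ (suc k)) *ℚ (M *ℚ ρ) ≡⟨ cong (_*ℚ (M *ℚ ρ)) fromℕ-φ₁ ⟩
          Φ′ *ℚ (M *ℚ ρ)                 ≡⟨ rational-telescoping-step M D Φ′ K K₁ p₀ p₁ q₀ q₁ a b Aₖ Aₖ₊₁ Bₖ₊₁ (⟦ δ ⟧₃ X Y K)
                                        h h′ t₀ t₁ t₁′ term-shift-n term-shift-k (harmonic-suc k) (certificate-T X Y S K) ⟩
          Φ′ *ℚ R                        ≡⟨ cong (_*ℚ R) fromℕ-φ₁ ⟨
          fromℕ (φℕ (suc k)) *ℚ R        ∎)
        regroup : ∀ u v h h′ G G′ → u -ℚ v +ℚ (h′ -ℚ h) *ℚ G′ +ℚ h *ℚ (G′ -ℚ G) ≡ (u +ℚ h′ *ℚ G′) -ℚ (v +ℚ h *ℚ G)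
        regroup = solve 6 (λ u v h h′ G G′ → u :- v :+ (h′ :- h) :* G′ :+ h :* (G′ :- G) := (u :+ h′ :* G′) :- (v :+ h :* G)) refl

  term-vanishes : ∀ {n k} → n < k → term n k ≡ 0ℚ
  term-vanishes {n} {k} n<k = trans (cong (λ c → (c * (n C k) * ((n + x) C k) * ((n + y) C k)) ÷ℕ denominator k) (k>n⇒nCk≡0 n<k))
                                    (0÷ℕ (denominator k))

  total weighted-total : ℕ → ℚ
  total      n = ∑ (suc n) (summand n)
  weighted-total n = ∑ (suc n) (weighted n)

  summand-vanishes : ∀ n → summand n (suc n) ≡ 0ℚ
  summand-vanishes n = trans (cong (_*ℚ c) (term-vanishes (ℕ.n<1+n n))) (ℚ.*-zeroˡ c)
    where
    c : ℚ
    c = 1ℚ +ℚ weight n (suc n) *ℚ harmonic (suc n)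

  weighted-vanishes : ∀ n → weighted n (suc n) ≡ 0ℚ
  weighted-vanishes n = trans (cong (weight n (suc n) *ℚ_) (term-vanishes (ℕ.n<1+n n))) (ℚ.*-zeroʳ (weight n (suc n)))

  weighted-antidifference-boundary : ∀ n → weighted-antidifference n (suc (suc n)) ≡ 0ℚ × weighted-antidifference n 0 ≡ 0ℚ
  weighted-antidifference-boundary n = last , first
    where
    K c B₀ t : ℚ
    K = fromℕ (suc (suc n))
    c = ⟦ ψ ⟧₃ X Y K *ℚ ⟦ B ⟧₄ X Y (S n) K
    B₀ = ⟦ B ⟧₄ X Y (S n) 0ℚ
    t = term (suc n) 0
    last : weighted-antidifference n (suc (suc n)) ≡ 0ℚ
    last = trans (cong (_*ℚ c) (term-vanishes (ℕ.n<1+n (suc n)))) (ℚ.*-zeroˡ c)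
    first : weighted-antidifference n 0 ≡ 0ℚ
    first = trans (cong (λ u → t *ℚ (u *ℚ B₀)) (ℚ.*-zeroˡ (⟦ φ ⟧₃ X Y 0ℚ)))
                  (trans (cong (t *ℚ_) (ℚ.*-zeroˡ B₀)) (ℚ.*-zeroʳ t))

  weighted-combination-sum : ∀ n → ∑ (suc (suc n)) (weighted-combination n) ≡ 0ℚ
  weighted-combination-sum n = ∑-telescope-vanishes {ψℕ (suc n)} (suc (suc n)) (weighted-combination n) (weighted-antidifference n) (s≤s z≤n)
    (λ k k<2+n → trans (cong (_*ℚ weighted-combination n k) (fromℕ-ψ (suc n))) (weighted-telescopes n k (ℕ.≤-pred k<2+n)))
    (proj₁ (weighted-antidifference-boundary n)) (proj₂ (weighted-antidifference-boundary n))

  antidifference-boundary : ∀ n → antidifference n (suc (suc n)) ≡ 0ℚ × antidifference n 0 ≡ 0ℚ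
  antidifference-boundary n = last , first
    where
    K c t h₀ hₑ : ℚ
    K = fromℕ (suc (suc n))
    c = K *ℚ ⟦ A ⟧₄ X Y (S n) K
    t = term (suc n) 0
    h₀ = harmonic 0
    hₑ = harmonic (suc (suc n))
    last : antidifference n (suc (suc n)) ≡ 0ℚ
    last = cong₂ _+ℚ_ (trans (cong (_*ℚ c) (term-vanishes (ℕ.n<1+n (suc n)))) (ℚ.*-zeroˡ c))
                      (trans (cong (hₑ *ℚ_) (proj₁ (weighted-antidifference-boundary n))) (ℚ.*-zeroʳ hₑ))
    first : antidifference n 0 ≡ 0ℚ
    first = cong₂ _+ℚ_ (trans (cong (t *ℚ_) (ℚ.*-zeroˡ (⟦ A ⟧₄ X Y (S n) 0ℚ))) (ℚ.*-zeroʳ t))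
                       (trans (cong (h₀ *ℚ_) (proj₂ (weighted-antidifference-boundary n))) (ℚ.*-zeroʳ h₀))

  summand-combination-sum : ∀ n → ∑ (suc (suc n)) (summand-combination n) ≡ 0ℚ
  summand-combination-sum n = ∑-telescope-vanishes {ψℕ (suc n)} (suc (suc n)) (summand-combination n) (antidifference n) (s≤s z≤n)
    (λ k k<2+n → trans (cong (_*ℚ summand-combination n k) (fromℕ-ψ (suc n))) (summand-telescopes n k (ℕ.≤-pred k<2+n)))
    (proj₁ (antidifference-boundary n)) (proj₂ (antidifference-boundary n))

  p₀ℕ p₁ℕ : ℕ → ℕ
  p₀ℕ n = suc n * suc n * (2 * suc n + x + y) * (2 * suc n + x + y) * suc (2 * n + x + y)
  p₁ℕ n = suc n * (2 * suc n + x + y) * (suc n + x + y) * (suc n + x) * (suc n + y)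

  fromℕ-p₁ : ∀ n → fromℕ (p₁ℕ n) ≡ ⟦ P₁ ⟧₃ X Y (S n)
  fromℕ-p₁ n = fromℕ-⟦⟧ (⌜ s ⌝ ⊗ (⌜ 2 ⌝ ⊗ ⌜ s ⌝ ⊕ ⌜ x ⌝ ⊕ ⌜ y ⌝) ⊗ (⌜ s ⌝ ⊕ ⌜ x ⌝ ⊕ ⌜ y ⌝) ⊗ (⌜ s ⌝ ⊕ ⌜ x ⌝) ⊗ (⌜ s ⌝ ⊕ ⌜ y ⌝))
    where
    s : ℕ
    s = suc n

  fromℕ-p₀ : ∀ n → fromℕ (p₀ℕ n) ≡ ⟦ P₀ ⟧₃ X Y (S n)
  fromℕ-p₀ n = begin
    fromℕ (p₀ℕ n)
      ≡⟨ fromℕ-* (s * s * w * w) (suc (2 * n + x + y)) ⟩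
    fromℕ (s * s * w * w) *ℚ fromℕ (suc (2 * n + x + y))
      ≡⟨ cong₂ _*ℚ_ (fromℕ-⟦⟧ (⌜ s ⌝ ⊗ ⌜ s ⌝ ⊗ ω ⊗ ω)) (fromℕ-suc (2 * n + x + y)) ⟩
    S n *ℚ S n *ℚ Wℚ *ℚ Wℚ *ℚ (fromℕ (2 * n + x + y) +ℚ 1ℚ)
      ≡⟨ cong (λ u → S n *ℚ S n *ℚ Wℚ *ℚ Wℚ *ℚ (u +ℚ 1ℚ)) (fromℕ-⟦⟧ (⌜ 2 ⌝ ⊗ ⌜ n ⌝ ⊕ ⌜ x ⌝ ⊕ ⌜ y ⌝)) ⟩
    S n *ℚ S n *ℚ Wℚ *ℚ Wℚ *ℚ (fromℕ 2 *ℚ N +ℚ X +ℚ Y +ℚ 1ℚ)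
      ≡⟨ cong (λ u → S n *ℚ S n *ℚ Wℚ *ℚ Wℚ *ℚ u)
              (trans (predecessor N X Y) (cong (λ Z → fromℕ 2 *ℚ Z +ℚ X +ℚ Y -ℚ 1ℚ) (sym (fromℕ-suc n)))) ⟩
    ⟦ P₀ ⟧₃ X Y (S n)
      ∎
    where
    open ≡-Reasoning
    s w : ℕ
    s = suc n
    w = 2 * s + x + y
    ω : ℕ-Expr
    ω = ⌜ 2 ⌝ ⊗ ⌜ s ⌝ ⊕ ⌜ x ⌝ ⊕ ⌜ y ⌝
    Wℚ N : ℚ
    Wℚ = ⟦ ω ⟧ℚ
    N = fromℕ n
    predecessor : ∀ N X Y → fromℕ 2 *ℚ N +ℚ X +ℚ Y +ℚ 1ℚ ≡ fromℕ 2 *ℚ (N +ℚ 1ℚ) +ℚ X +ℚ Y -ℚ 1ℚ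
    predecessor = solve 3 (λ N X Y → ν 2 :* N :+ X :+ Y :+ ν 1 := ν 2 :* (N :+ ν 1) :+ X :+ Y :- ν 1) refl

  weighted-recurrence : ∀ n → ⟦ P₀ ⟧₃ X Y (S n) *ℚ weighted-total n +ℚ fromℕ (p₁ℕ n) *ℚ weighted-total (suc n) ≡ 0ℚ
  weighted-recurrence n = begin
    p₀ *ℚ weighted-total n +ℚ fromℕ (p₁ℕ n) *ℚ weighted-total (suc n)
      ≡⟨ cong₂ (λ u v → p₀ *ℚ u +ℚ v *ℚ weighted-total (suc n))
               (sym (∑-suc-vanishing (suc n) (weighted n) (weighted-vanishes n))) (fromℕ-p₁ n) ⟩
    p₀ *ℚ ∑ (suc (suc n)) (weighted n) +ℚ p₁ *ℚ weighted-total (suc n)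
      ≡⟨ ∑-linear (suc (suc n)) p₀ p₁ (weighted n) (weighted (suc n)) ⟨
    ∑ (suc (suc n)) (weighted-combination n)
      ≡⟨ weighted-combination-sum n ⟩
    0ℚ
      ∎
    where
    open ≡-Reasoning
    p₀ p₁ : ℚ
    p₀ = ⟦ P₀ ⟧₃ X Y (S n)
    p₁ = ⟦ P₁ ⟧₃ X Y (S n)

  weighted-total-vanishes : ∀ n → weighted-total n ≡ 0ℚ
  weighted-total-vanishes = first-order-recurrence-unique (λ n → ⟦ P₀ ⟧₃ X Y (S n)) p₁ℕ (λ _ → s≤s z≤n)
    weighted-recurrence (λ n → cong₂ _+ℚ_ (ℚ.*-zeroʳ (⟦ P₀ ⟧₃ X Y (S n))) (ℚ.*-zeroʳ (fromℕ (p₁ℕ n)))) refl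

  total-recurrence : ∀ n → ⟦ P₀ ⟧₃ X Y (S n) *ℚ total n +ℚ fromℕ (p₁ℕ n) *ℚ total (suc n) ≡ 0ℚ
  total-recurrence n = begin
    p₀ *ℚ total n +ℚ fromℕ (p₁ℕ n) *ℚ total (suc n)
      ≡⟨ cong₂ (λ u v → p₀ *ℚ u +ℚ v *ℚ total (suc n))
               (sym (∑-suc-vanishing (suc n) (summand n) (summand-vanishes n))) (fromℕ-p₁ n) ⟩
    p₀ *ℚ ∑ m (summand n) +ℚ p₁ *ℚ total (suc n)
      ≡⟨ ℚ.+-identityʳ _ ⟨
    p₀ *ℚ ∑ m (summand n) +ℚ p₁ *ℚ total (suc n) +ℚ 0ℚ
      ≡⟨ cong (p₀ *ℚ ∑ m (summand n) +ℚ p₁ *ℚ total (suc n) +ℚ_) weighted-part ⟨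
    p₀ *ℚ ∑ m (summand n) +ℚ p₁ *ℚ total (suc n) +ℚ (q₀ *ℚ ∑ m (weighted n) +ℚ q₁ *ℚ weighted-total (suc n))
      ≡⟨ cong₂ _+ℚ_ (∑-linear m p₀ p₁ (summand n) (summand (suc n))) (∑-linear m q₀ q₁ (weighted n) (weighted (suc n))) ⟨
    ∑ m (λ k → p₀ *ℚ summand n k +ℚ p₁ *ℚ summand (suc n) k) +ℚ ∑ m (λ k → q₀ *ℚ weighted n k +ℚ q₁ *ℚ weighted (suc n) k)
      ≡⟨ ∑-+ m _ _ ⟨
    ∑ m (summand-combination n)
      ≡⟨ summand-combination-sum n ⟩
    0ℚ
      ∎
    where
    open ≡-Reasoning
    m : ℕ
    m = suc (suc n)
    p₀ p₁ q₀ q₁ : ℚ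
    p₀ = ⟦ P₀ ⟧₃ X Y (S n)
    p₁ = ⟦ P₁ ⟧₃ X Y (S n)
    q₀ = ⟦ Q₀ ⟧₃ X Y (S n)
    q₁ = ⟦ Q₁ ⟧₃ X Y (S n)
    weighted-part : q₀ *ℚ ∑ m (weighted n) +ℚ q₁ *ℚ weighted-total (suc n) ≡ 0ℚ
    weighted-part = begin
      q₀ *ℚ ∑ m (weighted n) +ℚ q₁ *ℚ weighted-total (suc n)
        ≡⟨ cong₂ (λ u v → q₀ *ℚ u +ℚ q₁ *ℚ v)
                 (trans (∑-suc-vanishing (suc n) (weighted n) (weighted-vanishes n)) (weighted-total-vanishes n))
                 (weighted-total-vanishes (suc n)) ⟩
      q₀ *ℚ 0ℚ +ℚ q₁ *ℚ 0ℚ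
        ≡⟨ cong₂ _+ℚ_ (ℚ.*-zeroʳ q₀) (ℚ.*-zeroʳ q₁) ⟩
      0ℚ
        ∎

  central denominatorₙ : ℕ → ℕ
  central n = (2 * n + x + y) C n
  denominatorₙ n = ((n + x) C n) * ((n + y) C n)

  closed-form : ℕ → ℚ
  closed-form n = sign n *ℚ (central n ÷ℕ denominatorₙ n)

  closed-form-ratio : ∀ n → central n * denominatorₙ (suc n) * p₀ℕ n ≡ central (suc n) * denominatorₙ n * p₁ℕ n
  closed-form-ratio n = ℕ.*-cancelʳ-≡ _ _ (s * s) (begin
    c * (ex * ey) * (s * s * w * w * m₁) * (s * s)              ≡⟨ regroup c ex ey s w m₁ ⟩
    (s * ex) * (s * ey) * (s * s) * (w * w * (m₁ * c))          ≡⟨ cong₂ (λ u v → u * v * (s * s) * (w * w * (m₁ * c))) absorbˣ absorbʸ ⟩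
    ((s + x) * dx) * ((s + y) * dy) * (s * s) * (w * w * (m₁ * c)) ≡⟨ cong (λ u → ((s + x) * dx) * ((s + y) * dy) * (s * s) * (w * w * u)) shift ⟨
    ((s + x) * dx) * ((s + y) * dy) * (s * s) * (w * w * (b * u)) ≡⟨ regroup′ dx dy s x y w b u ⟩
    (w * b) * (dx * dy * w * u * (s + x) * (s + y) * (s * s))          ≡⟨ cong (_* (dx * dy * w * u * (s + x) * (s + y) * (s * s))) absorb ⟨
    (s * a) * (dx * dy * w * u * (s + x) * (s + y) * (s * s))          ≡⟨ regroup″ a dx dy s x y w u ⟩
    a * (dx * dy) * (s * w * u * (s + x) * (s + y)) * (s * s)    ∎)
    where
    open ≡-Reasoning
    s w m₁ u c a b dx dy ex ey : ℕ
    s = suc n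
    w = 2 * s + x + y
    m₁ = suc (2 * n + x + y)
    u = s + x + y
    c = central n
    a = central s
    b = m₁ C n
    dx = (n + x) C n
    dy = (n + y) C n
    ex = (s + x) C s
    ey = (s + y) C s
    w≡2+2n+x+y : w ≡ suc m₁
    w≡2+2n+x+y = solve-∀′ n x y
      where
      solve-∀′ : ∀ n x y → 2 * suc n + x + y ≡ suc (suc (2 * n + x + y))
      solve-∀′ = solve-∀
    absorb : s * a ≡ w * b
    absorb = trans (cong (λ v → s * (v C s)) w≡2+2n+x+y)
                   (trans (C-absorb m₁ n) (cong (_* b) (sym w≡2+2n+x+y)))
    shift : b * u ≡ m₁ * c
    shift = C-shift n u (n+u n x y)
      where
      n+u : ∀ n x y → n + (suc n + x + y) ≡ suc (2 * n + x + y)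
      n+u = solve-∀
    absorbˣ : s * ex ≡ (s + x) * dx
    absorbˣ = C-absorb (n + x) n
    absorbʸ : s * ey ≡ (s + y) * dy
    absorbʸ = C-absorb (n + y) n
    regroup : ∀ c ex ey s w m₁ → c * (ex * ey) * (s * s * w * w * m₁) * (s * s) ≡ (s * ex) * (s * ey) * (s * s) * (w * w * (m₁ * c))
    regroup = solve-∀
    regroup′ : ∀ dx dy s x y w b u →
      ((s + x) * dx) * ((s + y) * dy) * (s * s) * (w * w * (b * u)) ≡ (w * b) * (dx * dy * w * u * (s + x) * (s + y) * (s * s))
    regroup′ = solve-∀
    regroup″ : ∀ a dx dy s x y w u →
      (s * a) * (dx * dy * w * u * (s + x) * (s + y) * (s * s)) ≡ a * (dx * dy) * (s * w * u * (s + x) * (s + y)) * (s * s)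
    regroup″ = solve-∀

  closed-form-recurrence : ∀ n → ⟦ P₀ ⟧₃ X Y (S n) *ℚ closed-form n +ℚ fromℕ (p₁ℕ n) *ℚ closed-form (suc n) ≡ 0ℚ
  closed-form-recurrence n = begin
    ⟦ P₀ ⟧₃ X Y (S n) *ℚ (σ *ℚ q) +ℚ e₁ *ℚ (ℚ.- σ *ℚ q′)
      ≡⟨ cong (λ u → u *ℚ (σ *ℚ q) +ℚ e₁ *ℚ (ℚ.- σ *ℚ q′)) (fromℕ-p₀ n) ⟨
    e₀ *ℚ (σ *ℚ q) +ℚ e₁ *ℚ (ℚ.- σ *ℚ q′)
      ≡⟨ factor-sign σ q q′ e₀ e₁ ⟩
    σ *ℚ (q *ℚ e₀ -ℚ q′ *ℚ e₁)
      ≡⟨ cong (λ u → σ *ℚ (u -ℚ q′ *ℚ e₁)) (÷ℕ-*-cross (p₀ℕ n) (p₁ℕ n) (positive n) (positive (suc n)) (closed-form-ratio n)) ⟩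
    σ *ℚ (q′ *ℚ e₁ -ℚ q′ *ℚ e₁)
      ≡⟨ cong (σ *ℚ_) (ℚ.+-inverseʳ (q′ *ℚ e₁)) ⟩
    σ *ℚ 0ℚ
      ≡⟨ ℚ.*-zeroʳ σ ⟩
    0ℚ
      ∎
    where
    open ≡-Reasoning
    σ q q′ e₀ e₁ : ℚ
    σ = sign n
    q = central n ÷ℕ denominatorₙ n
    q′ = central (suc n) ÷ℕ denominatorₙ (suc n)
    e₀ = fromℕ (p₀ℕ n)
    e₁ = fromℕ (p₁ℕ n)
    positive : ∀ m → 0 < denominatorₙ m
    positive m = ℕ.*-mono-< (C-pos (ℕ.m≤m+n m x)) (C-pos (ℕ.m≤m+n m y))
    factor-sign : ∀ σ q q′ e₀ e₁ → e₀ *ℚ (σ *ℚ q) +ℚ e₁ *ℚ (ℚ.- σ *ℚ q′) ≡ σ *ℚ (q *ℚ e₀ -ℚ q′ *ℚ e₁)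
    factor-sign = solve 5 (λ σ q q′ e₀ e₁ → e₀ :* (σ :* q) :+ e₁ :* (:- σ :* q′) := σ :* (q :* e₀ :- q′ :* e₁)) refl

  total≡closed-form : ∀ n → total n ≡ closed-form n
  total≡closed-form = first-order-recurrence-unique (λ n → ⟦ P₀ ⟧₃ X Y (S n)) p₁ℕ (λ _ → s≤s z≤n)
    total-recurrence closed-form-recurrence (cong (λ u → 0ℚ +ℚ term 0 0 *ℚ (1ℚ +ℚ u)) (ℚ.*-zeroˡ (harmonic 0)))

theorem7 : (n b d : ℕ) →
    sumTo n (λ k →
      (((n C k) * (n C k) * ((n + b * n) C k) * ((n + d * n) C k))
        ÷ℕ (((k + b * n) C k) * ((k + d * n) C k)))
      *ℚ ((+ 1 / 1) +ℚ (((+ n / 1) -ℚ (+ (2 * k) / 1))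
            *ℚ ((+ 2 / 1) *ℚ H k +ℚ H (b * n + k) +ℚ H (d * n + k)))))
    ≡ sign n *ℚ (((2 * n + b * n + d * n) C n)
                   ÷ℕ (((n + b * n) C n) * ((n + d * n) C n)))
theorem7 n b d = trans (sumTo≡∑ n (summand x y n)) (total≡closed-form x y n)
  where
  x y : ℕ
  x = b * n
  y = d * n
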